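{- Let $F$ be a formally real, non-pythagorean field, let $n\in\mathbb N$, and let $\varphi$ be an $n$-fold Pfister form over $F$ which is the supreme torsion form over $F$. Suppose the Pythagoras number satisfies $p(F)>2^{n-1}$. Then $[D_F(\infty):D_F(2^{n-1})]=2$.
   Context: Quadratic forms are nondegenerate and finite-dimensional. A form is torsion if its Witt class is torsion in the Witt ring $WF$. A supreme torsion form over $F$ is an anisotropic torsion form such that every anisotropic torsion form over $F$ is similar to a subform of it. An $n$-fold Pfister form is $\langle1,-a_1\rangle\otimes\cdots\otimes\langle1,-a_n\rangle$ with $a_i\in F^\ast$. For $k\in\mathbb N$, $D_F(k)$ is the set of nonzero elements of $F$ that are sums of $k$ squares, and $D_F(\infty)=\bigcup_k D_F(k)=\sum F^{\ast2}$ is the group of nonzero sums of squares. The Pythagoras number $p(F)$ is the least $m$ such that every element of $\sum F^{\ast 2}$ is a sum of $m$ squares ($\infty$ if none exists). -}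

module Defs where

open import Level using (Level; _⊔_) renaming (suc to lsuc)
open import Data.Nat using (ℕ; zero; suc; _<_)
open import Data.Fin using (Fin; zero; suc)
open import Data.List using (List; []; _∷_; _++_; map; length; replicate; concat)
open import Data.List.Relation.Unary.All using (All)
open import Data.Product using (Σ; ∃; _×_; _,_)
open import Data.Sum using (_⊎_)
open import Relation.Nullary using (¬_)
open import Algebra.Bundles using (CommutativeRing)

record Field (c ℓ : Level) : Set (lsuc (c ⊔ ℓ)) where
  field
    commutativeRing : CommutativeRing c ℓ
  open CommutativeRing commutativeRing public
  field
    1≉0     : ¬ (1# ≈ 0#)
    inverse : ∀ x → ¬ (x ≈ 0#) → ∃ λ y → x * y ≈ 1#

module QuadraticForms {c ℓ : Level} (F : Field c ℓ) where
  open Field F using (Carrier; _≈_; _+_; _*_; -_; 0#; 1#)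
  private K = Carrier

  Nonzero : K → Set ℓ
  Nonzero x = ¬ (x ≈ 0#)

  sumFin : (n : ℕ) → (Fin n → K) → K
  sumFin zero    f = 0#
  sumFin (suc n) f = f zero + sumFin n (λ i → f (suc i))

  -- A (diagonal) quadratic form ⟨a₁,…,aₙ⟩ is its list of coefficients;
  -- it is nondegenerate iff all coefficients are nonzero.
  Form : Set c
  Form = List K

  Nondegenerate : Form → Set (c ⊔ ℓ)
  Nondegenerate φ = All Nonzero φ

  dim : Form → ℕ
  dim = length

  Vector : Form → Set c
  Vector φ = Fin (dim φ) → K

  value : (φ : Form) → Vector φ → K
  value []      x = 0#
  value (a ∷ φ) x = a * (x zero * x zero) + value φ (λ i → x (suc i))

  _⊥_ : Form → Form → Form
  φ ⊥ ψ = φ ++ ψ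

  scale : K → Form → Form
  scale c φ = map (c *_) φ

  apply : ∀ {m n} → (Fin m → Fin n → K) → (Fin n → K) → (Fin m → K)
  apply {n = n} M x i = sumFin n (λ j → M i j * x j)

  Isometric : Form → Form → Set (c ⊔ ℓ)
  Isometric φ ψ =
    Σ (Fin (dim ψ) → Fin (dim φ) → K) λ T →
    Σ (Fin (dim φ) → Fin (dim ψ) → K) λ S →
      (∀ x i → apply S (apply T x) i ≈ x i) ×
      (∀ y i → apply T (apply S y) i ≈ y i) ×
      (∀ x → value ψ (apply T x) ≈ value φ x)

  Anisotropic : Form → Set (c ⊔ ℓ)
  Anisotropic φ = ∀ (x : Vector φ) → value φ x ≈ 0# → ∀ i → x i ≈ 0#

  hyperbolicPlane : Form
  hyperbolicPlane = 1# ∷ (- 1#) ∷ []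

  hyperbolic : ℕ → Form
  hyperbolic k = concat (replicate k hyperbolicPlane)

  multiple : ℕ → Form → Form
  multiple m φ = concat (replicate m φ)

  -- The Witt class of φ is zero iff φ is hyperbolic.
  WittZero : Form → Set (c ⊔ ℓ)
  WittZero φ = ∃ λ k → Isometric φ (hyperbolic k)

  Torsion : Form → Set (c ⊔ ℓ)
  Torsion φ = ∃ λ m → 0 < m × WittZero (multiple m φ)

  SimilarToSubform : Form → Form → Set (c ⊔ ℓ)
  SimilarToSubform ψ φ =
    Σ K λ a → Nonzero a × Σ Form λ χ → Nondegenerate χ × Isometric φ (scale a ψ ⊥ χ)

  SupremeTorsion : Form → Set (c ⊔ ℓ)
  SupremeTorsion φ =
    Nondegenerate φ × Anisotropic φ × Torsion φ ×
    (∀ ψ → Nondegenerate ψ → Anisotropic ψ → Torsion ψ → SimilarToSubform ψ φ)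

  -- ⟨⟨a₁,…,aₙ⟩⟩ = ⟨1,-a₁⟩ ⊗ ⋯ ⊗ ⟨1,-aₙ⟩, using ⟨1,-a⟩ ⊗ ρ = ρ ⊥ (-a)ρ.
  pfister : (n : ℕ) → (Fin n → K) → Form
  pfister zero    a = 1# ∷ []
  pfister (suc n) a = ρ ⊥ scale (- a zero) ρ
    where ρ = pfister n (λ i → a (suc i))

  IsPfister : ℕ → Form → Set (c ⊔ ℓ)
  IsPfister n φ = Σ (Fin n → K) λ a → (∀ i → Nonzero (a i)) × Isometric φ (pfister n a)

  D : ℕ → K → Set (c ⊔ ℓ)
  D k x = Nonzero x × Σ (Fin k → K) λ y → x ≈ sumFin k (λ i → y i * y i)

  D∞ : K → Set (c ⊔ ℓ)
  D∞ x = ∃ λ k → D k x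

  FormallyReal : Set (c ⊔ ℓ)
  FormallyReal = ¬ D∞ (- 1#)

  Pythagorean : Set (c ⊔ ℓ)
  Pythagorean = ∀ x → D∞ x → D 1 x

  -- p(F) ≤ m  iff every element of D_F(∞) is a sum of m squares.
  PythagorasAtMost : ℕ → Set (c ⊔ ℓ)
  PythagorasAtMost m = ∀ x → D∞ x → D m x

  -- [D_F(∞) : D_F(m)] = 2: there is t ∈ D_F(∞) ∖ D_F(m) with
  -- D_F(∞) = D_F(m) ∪ t·D_F(m)  (D_F(m) ⊆ D_F(∞) holds by definition).
  IndexTwo : ℕ → Set (c ⊔ ℓ)
  IndexTwo m =
    Σ K λ t → D∞ t × ¬ D m t ×
      (∀ x → D∞ x → D m x ⊎ (Σ K λ y → D m y × x ≈ t * y))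

{-# OPTIONS --safe #-}
-- Let m = 2ⁿ⁻¹ and σ = ⟨⟨−1, …, −1⟩⟩ ≅ m × ⟨1⟩, a round form whose nonzero
-- values are D_F(m).  For t ∈ D_F(∞) ∖ D_F(m) the n-fold Pfister form
-- π_t = σ ⊥ −t σ is anisotropic (an isotropic vector would write t as a quotient
-- of values of σ) and torsion (2ʲ π_t ≅ σ′ ⊥ −t σ′ for σ′ = 2ʲ⁺ⁿ⁻¹ × ⟨1⟩, which
-- is round and represents t once j squares suffice for t, so it is hyperbolic).
-- As dim π_t ≥ dim φ, supremacy makes φ similar to π_t.  So for two such
-- elements x and t the forms π_x and π_t are similar, hence isometric (π_t is
-- round and π_x represents 1), and Witt cancellation of σ leaves x σ ≅ t σ,
-- i.e. x ∈ t · D_F(m).  Thus D_F(∞) ∖ D_F(m), nonempty as p(F) > m, is a single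
-- coset of D_F(m).
module Submission where

open import Algebra.Bundles using (CommutativeRing; RawRing)
open import Data.Empty using (⊥-elim)
open import Data.Fin as Fin using (Fin; zero; suc; punchIn)
import Data.Fin.Properties as Fin
open import Data.List as List using ([]; _∷_; map; replicate)
import Data.List.Properties as List
open import Data.List.Relation.Binary.Pointwise.Base using (Pointwise; []; _∷_)
open import Data.List.Relation.Binary.Pointwise.Properties using (Pointwise-length)
import Data.List.Relation.Binary.Permutation.Setoid as Permutation
import Data.List.Relation.Binary.Permutation.Setoid.Properties as PermutationProperties
open import Data.List.Relation.Unary.All as All using (All; []; _∷_)
import Data.List.Relation.Unary.All.Properties as All
open import Data.Maybe using (Maybe; just; nothing)
open import Data.Nat as ℕ using (ℕ; zero; suc; z≤n; s≤s; _^_; _∸_; _≤′_)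
import Data.Nat.Properties as ℕ
open import Data.Product using (Σ; ∃; _×_; _,_; proj₁; proj₂)
open import Data.Sum using (_⊎_; inj₁; inj₂)
open import Data.Vec.Functional using (insertAt; tail) renaming (_∷_ to _∷ᵛ_)
open import Data.Vec.Functional.Properties using (insertAt-lookup; insertAt-punchIn)
open import Level using (Level; _⊔_; 0ℓ; Lift; lift; lower)
open import Relation.Binary.PropositionalEquality as ≡ using (_≡_)
open import Relation.Nullary using (¬_; Dec; yes; no)
open import Relation.Nullary.Decidable using (map′; decidable-stable)
import Algebra.Properties.CommutativeSemigroup as CommutativeSemigroupProperties
import Algebra.Properties.Ring as RingProperties
import Algebra.Properties.Semiring.Mult.TCOptimised as Multiples
import Algebra.Solver.Ring as RingSolver
import Algebra.Solver.Ring.AlmostCommutativeRing as ACR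
import Relation.Binary.Reasoning.Setoid as SetoidReasoning
import Tactic.RingSolver.Core.AlmostCommutativeRing as TACR
import Tactic.RingSolver.NonReflective as NonReflective

open import Defs

-- The library's solvers over a bare commutative ring take its own elements as
-- coefficients and, lacking decidable equality, cannot cancel x − x.  This one
-- uses integer coefficients: a − b is the pair (a , b), kept with one
-- component 0 so that equal integers are equal pairs.
ℤ² : Set
ℤ² = ℕ × ℕ

normalise : ℤ² → ℤ²
normalise (a , b) = a ∸ b , b ∸ a

ℤ²-rawRing : RawRing 0ℓ 0ℓ
ℤ²-rawRing = record
  { Carrier = ℤ²
  ; _≈_ = _≡_
  ; _+_ = λ { (a , b) (c , d) → normalise (a ℕ.+ c , b ℕ.+ d) }
  ; _*_ = λ { (a , b) (c , d) → normalise (a ℕ.* c ℕ.+ b ℕ.* d , a ℕ.* d ℕ.+ b ℕ.* c) }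
  ; -_ = λ { (a , b) → b , a }
  ; 0# = 0 , 0
  ; 1# = 1 , 0
  }

module ℤ²Solver {c ℓ} (R : CommutativeRing c ℓ) where
  open CommutativeRing R
  open SetoidReasoning setoid
  open RingProperties ring using (-0#≈0#; -‿distribˡ-*; -‿distribʳ-*; -‿involutive; -‿+-comm; ⁻¹-anti-homo‿-)
  open Multiples semiring using (×-homo-+; ×1-homo-*) renaming (_×_ to _·_)

  ⟦_⟧ : ℤ² → Carrier
  ⟦ a , zero ⟧      = a · 1#
  ⟦ zero , suc b ⟧  = - (suc b · 1#)
  ⟦ suc a , suc b ⟧ = ⟦ a , b ⟧

  private
    module N = NonReflective (TACR.fromCommutativeRing R (λ _ → nothing))

    difference : ℕ → ℕ → Carrier
    difference a b = a · 1# - b · 1#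

    cancelˡ-− : ∀ x y z → (x + y) - (x + z) ≈ y - z
    cancelˡ-− x y z = begin
      (x + y) - (x + z)   ≈⟨ N.solve 3 (λ x y z → ((x N.⊕ y) N.⊕ N.⊝ (x N.⊕ z)) N.⊜ ((y N.⊕ N.⊝ z) N.⊕ (x N.⊕ N.⊝ x))) refl x y z ⟩
      (y - z) + (x - x)   ≈⟨ +-congˡ (-‿inverseʳ x) ⟩
      (y - z) + 0#        ≈⟨ +-identityʳ _ ⟩
      y - z               ∎

    ⟦⟧-difference : ∀ a b → ⟦ a , b ⟧ ≈ difference a b
    ⟦⟧-difference a       zero    = sym (trans (+-congˡ -0#≈0#) (+-identityʳ _))
    ⟦⟧-difference zero    (suc b) = sym (+-identityˡ _)
    ⟦⟧-difference (suc a) (suc b) = begin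
      ⟦ a , b ⟧                        ≈⟨ ⟦⟧-difference a b ⟩
      a · 1# - b · 1#                  ≈⟨ cancelˡ-− 1# _ _ ⟨
      (1# + a · 1#) - (1# + b · 1#)    ≈⟨ +-cong (×-homo-+ 1# 1 a) (-‿cong (×-homo-+ 1# 1 b)) ⟨
      suc a · 1# - suc b · 1#          ∎

    ⟦normalise⟧ : ∀ a b → ⟦ normalise (a , b) ⟧ ≈ difference a b
    ⟦normalise⟧ a b = trans (⟦⟧-difference (a ∸ b) (b ∸ a)) (∸-difference a b)
      where
      ∸-difference : ∀ a b → difference (a ∸ b) (b ∸ a) ≈ difference a b
      ∸-difference zero    zero    = refl
      ∸-difference zero    (suc b) = refl
      ∸-difference (suc a) zero    = refl
      ∸-difference (suc a) (suc b) =
        trans (∸-difference a b) (trans (sym (⟦⟧-difference a b)) (⟦⟧-difference (suc a) (suc b)))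

    difference-+ : ∀ a b c d → difference (a ℕ.+ c) (b ℕ.+ d) ≈ difference a b + difference c d
    difference-+ a b c d = begin
      (a ℕ.+ c) · 1# - (b ℕ.+ d) · 1#         ≈⟨ +-cong (×-homo-+ 1# a c) (-‿cong (×-homo-+ 1# b d)) ⟩
      (a · 1# + c · 1#) - (b · 1# + d · 1#)
        ≈⟨ N.solve 4 (λ x y z w → ((x N.⊕ z) N.⊕ N.⊝ (y N.⊕ w)) N.⊜ ((x N.⊕ N.⊝ y) N.⊕ (z N.⊕ N.⊝ w)))
                   refl (a · 1#) (b · 1#) (c · 1#) (d · 1#) ⟩
      difference a b + difference c d         ∎

    [x-y][z-w] : ∀ x y z w → (x - y) * (z - w) ≈ (x * z + y * w) - (x * w + y * z)
    [x-y][z-w] x y z w = begin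
      (x - y) * (z - w)
        ≈⟨ N.solve 4 (λ x y′ z w′ → ((x N.⊕ y′) N.⊗ (z N.⊕ w′)) N.⊜ ((x N.⊗ z N.⊕ y′ N.⊗ w′) N.⊕ (x N.⊗ w′ N.⊕ y′ N.⊗ z)))
                   refl x (- y) z (- w) ⟩
      (x * z + - y * - w) + (x * - w + - y * z)
        ≈⟨ +-cong (+-congˡ -y*-w≈y*w) (trans (+-cong (sym (-‿distribʳ-* x w)) (sym (-‿distribˡ-* y z))) (-‿+-comm _ _)) ⟩
      (x * z + y * w) - (x * w + y * z)           ∎
      where
      -y*-w≈y*w : - y * - w ≈ y * w
      -y*-w≈y*w = trans (sym (-‿distribˡ-* y (- w))) (trans (-‿cong (sym (-‿distribʳ-* y w))) (-‿involutive _))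

    ·1#-homo-*+* : ∀ m n p q → (m ℕ.* n ℕ.+ p ℕ.* q) · 1# ≈ (m · 1#) * (n · 1#) + (p · 1#) * (q · 1#)
    ·1#-homo-*+* m n p q = trans (×-homo-+ 1# (m ℕ.* n) (p ℕ.* q)) (+-cong (×1-homo-* m n) (×1-homo-* p q))

    difference-* : ∀ a b c d → difference (a ℕ.* c ℕ.+ b ℕ.* d) (a ℕ.* d ℕ.+ b ℕ.* c) ≈ difference a b * difference c d
    difference-* a b c d = trans (+-cong (·1#-homo-*+* a c b d) (-‿cong (·1#-homo-*+* a d b c))) (sym ([x-y][z-w] _ _ _ _))

  morphism : ℤ²-rawRing ACR.-Raw-AlmostCommutative⟶ ACR.fromCommutativeRing R
  morphism = record
    { ⟦_⟧ = ⟦_⟧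
    ; +-homo = λ { (a , b) (c , d) → trans (⟦normalise⟧ (a ℕ.+ c) (b ℕ.+ d))
                     (trans (difference-+ a b c d) (sym (+-cong (⟦⟧-difference a b) (⟦⟧-difference c d)))) }
    ; *-homo = λ { (a , b) (c , d) → trans (⟦normalise⟧ (a ℕ.* c ℕ.+ b ℕ.* d) (a ℕ.* d ℕ.+ b ℕ.* c))
                     (trans (difference-* a b c d) (sym (*-cong (⟦⟧-difference a b) (⟦⟧-difference c d)))) }
    ; -‿homo = λ { (a , b) → trans (⟦⟧-difference b a) (trans (sym (⁻¹-anti-homo‿- _ _)) (-‿cong (sym (⟦⟧-difference a b)))) }
    ; 0-homo = refl
    ; 1-homo = refl
    }

  _≟-coefficient_ : ∀ p q → Maybe (⟦ p ⟧ ≈ ⟦ q ⟧)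
  (a , b) ≟-coefficient (c , d) with a ℕ.≟ c | b ℕ.≟ d
  ... | yes ≡.refl | yes ≡.refl = just refl
  ... | _          | _          = nothing

  open RingSolver ℤ²-rawRing (ACR.fromCommutativeRing R) morphism _≟-coefficient_ public
    using (solve; _:=_; _:+_; _:*_; _:-_; :-_; con)

module FormTheory {c ℓ} (F : Field c ℓ) (≈0? : ∀ x → Dec (Field._≈_ F x (Field.0# F))) where
  open Field F hiding (zero)
  open QuadraticForms F
  open RingProperties ring
  open CommutativeSemigroupProperties *-commutativeSemigroup using (x∙yz≈y∙xz) renaming (interchange to *-interchange)
  open SetoidReasoning setoid
  open ℤ²Solver commutativeRing

  private
    K : Set c
    K = Carrier

  _⁻¹⟨_⟩ : (x : K) → Nonzero x → K
  x ⁻¹⟨ x≉0 ⟩ = proj₁ (inverse x x≉0)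

  *-inverseʳ : ∀ x (x≉0 : Nonzero x) → x * x ⁻¹⟨ x≉0 ⟩ ≈ 1#
  *-inverseʳ x x≉0 = proj₂ (inverse x x≉0)

  *-inverseˡ : ∀ x (x≉0 : Nonzero x) → x ⁻¹⟨ x≉0 ⟩ * x ≈ 1#
  *-inverseˡ x x≉0 = trans (*-comm _ _) (*-inverseʳ x x≉0)

  *-cancelˡ : ∀ {a x y} → Nonzero a → a * x ≈ a * y → x ≈ y
  *-cancelˡ {a} {x} {y} a≉0 ax≈ay = begin
    x                        ≈⟨ *-identityˡ x ⟨
    1# * x                   ≈⟨ *-congʳ (*-inverseˡ a a≉0) ⟨
    (a ⁻¹⟨ a≉0 ⟩ * a) * x    ≈⟨ *-assoc _ _ _ ⟩
    a ⁻¹⟨ a≉0 ⟩ * (a * x)    ≈⟨ *-congˡ ax≈ay ⟩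
    a ⁻¹⟨ a≉0 ⟩ * (a * y)    ≈⟨ *-assoc _ _ _ ⟨
    (a ⁻¹⟨ a≉0 ⟩ * a) * y    ≈⟨ *-congʳ (*-inverseˡ a a≉0) ⟩
    1# * y                   ≈⟨ *-identityˡ y ⟩
    y                        ∎

  nonzero-cong : ∀ {a b} → a ≈ b → Nonzero a → Nonzero b
  nonzero-cong a≈b a≉0 b≈0 = a≉0 (trans a≈b b≈0)

  *-nonzero : ∀ {a b} → Nonzero a → Nonzero b → Nonzero (a * b)
  *-nonzero {a} {b} a≉0 b≉0 ab≈0 = b≉0 (*-cancelˡ a≉0 (trans ab≈0 (sym (zeroʳ a))))

  nonzero-factorʳ : ∀ {a b} → Nonzero (a * b) → Nonzero b
  nonzero-factorʳ {a} ab≉0 b≈0 = ab≉0 (trans (*-congˡ b≈0) (zeroʳ a))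

  -‿nonzero : ∀ {a} → Nonzero a → Nonzero (- a)
  -‿nonzero {a} a≉0 -a≈0 = a≉0 (trans (sym (-‿involutive a)) (trans (-‿cong -a≈0) -0#≈0#))

  infix  4 _≋_
  infixl 6 _+ᵛ_
  infixl 7 _·ᵛ_

  _≋_ : ∀ {n} → (Fin n → K) → (Fin n → K) → Set ℓ
  u ≋ v = ∀ i → u i ≈ v i

  0ᵛ : ∀ {n} → Fin n → K
  0ᵛ _ = 0#

  _+ᵛ_ : ∀ {n} → (Fin n → K) → (Fin n → K) → Fin n → K
  (u +ᵛ v) i = u i + v i

  _·ᵛ_ : ∀ {n} → K → (Fin n → K) → Fin n → K
  (a ·ᵛ v) i = a * v i

  -ᵛ_ : ∀ {n} → (Fin n → K) → Fin n → K
  (-ᵛ v) i = - v i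

  ≋-refl : ∀ {n} {u : Fin n → K} → u ≋ u
  ≋-refl i = refl

  ≋-sym : ∀ {n} {u v : Fin n → K} → u ≋ v → v ≋ u
  ≋-sym p i = sym (p i)

  ≋-trans : ∀ {n} {u v w : Fin n → K} → u ≋ v → v ≋ w → u ≋ w
  ≋-trans p q i = trans (p i) (q i)

  sumFin-cong : ∀ n {f g : Fin n → K} → f ≋ g → sumFin n f ≈ sumFin n g
  sumFin-cong zero    f≋g = refl
  sumFin-cong (suc n) f≋g = +-cong (f≋g zero) (sumFin-cong n (λ i → f≋g (suc i)))

  sumFin-0 : ∀ n {f : Fin n → K} → f ≋ 0ᵛ → sumFin n f ≈ 0#
  sumFin-0 zero    f≋0 = refl
  sumFin-0 (suc n) f≋0 = trans (+-cong (f≋0 zero) (sumFin-0 n (λ i → f≋0 (suc i)))) (+-identityˡ 0#)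

  sumFin-+ : ∀ n (f g : Fin n → K) → sumFin n (f +ᵛ g) ≈ sumFin n f + sumFin n g
  sumFin-+ zero    f g = sym (+-identityˡ 0#)
  sumFin-+ (suc n) f g = trans (+-congˡ (sumFin-+ n _ _))
    (solve 4 (λ a b x y → ((a :+ b) :+ (x :+ y)) := ((a :+ x) :+ (b :+ y))) refl (f zero) (g zero) _ _)

  sumFin-* : ∀ n a (f : Fin n → K) → sumFin n (a ·ᵛ f) ≈ a * sumFin n f
  sumFin-* zero    a f = sym (zeroʳ a)
  sumFin-* (suc n) a f = trans (+-congˡ (sumFin-* n a _)) (sym (distribˡ _ _ _))

  sumFin-neg : ∀ n (f : Fin n → K) → sumFin n (-ᵛ f) ≈ - sumFin n f
  sumFin-neg zero    f = sym -0#≈0#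
  sumFin-neg (suc n) f = trans (+-congˡ (sumFin-neg n _)) (-‿+-comm _ _)

  sumFin-punchIn : ∀ n j (f : Fin (suc n) → K) → sumFin (suc n) f ≈ f j + sumFin n (λ k → f (punchIn j k))
  sumFin-punchIn n       zero    f = refl
  sumFin-punchIn (suc n) (suc j) f = trans (+-congˡ (sumFin-punchIn n j (λ i → f (suc i))))
    (solve 3 (λ a b x → (a :+ (b :+ x)) := (b :+ (a :+ x))) refl (f zero) (f (suc j)) _)

  weightedSum : (φ : Form) → Vector φ → K
  weightedSum []      f = 0#
  weightedSum (a ∷ φ) f = a * f zero + weightedSum φ (λ i → f (suc i))

  value≈weightedSum : ∀ φ x → value φ x ≈ weightedSum φ (λ i → x i * x i)
  value≈weightedSum []      x = refl
  value≈weightedSum (a ∷ φ) x = +-congˡ (value≈weightedSum φ (λ i → x (suc i)))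

  weightedSum-cong : ∀ φ {f g} → f ≋ g → weightedSum φ f ≈ weightedSum φ g
  weightedSum-cong []      f≋g = refl
  weightedSum-cong (a ∷ φ) f≋g = +-cong (*-congˡ (f≋g zero)) (weightedSum-cong φ (λ i → f≋g (suc i)))

  weightedSum-0 : ∀ φ {f} → f ≋ 0ᵛ → weightedSum φ f ≈ 0#
  weightedSum-0 []      f≋0 = refl
  weightedSum-0 (a ∷ φ) f≋0 =
    trans (+-cong (trans (*-congˡ (f≋0 zero)) (zeroʳ a)) (weightedSum-0 φ (λ i → f≋0 (suc i)))) (+-identityˡ 0#)

  weightedSum-+ : ∀ φ f g → weightedSum φ (f +ᵛ g) ≈ weightedSum φ f + weightedSum φ g
  weightedSum-+ []      f g = sym (+-identityˡ 0#)
  weightedSum-+ (a ∷ φ) f g = trans (+-congˡ (weightedSum-+ φ _ _))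
    (solve 5 (λ a f g x y → (a :* (f :+ g) :+ (x :+ y)) := ((a :* f :+ x) :+ (a :* g :+ y))) refl a (f zero) (g zero) _ _)

  weightedSum-* : ∀ φ b f → weightedSum φ (b ·ᵛ f) ≈ b * weightedSum φ f
  weightedSum-* []      b f = sym (zeroʳ b)
  weightedSum-* (a ∷ φ) b f = trans (+-congˡ (weightedSum-* φ b _))
    (solve 4 (λ a b f x → (a :* (b :* f) :+ b :* x) := (b :* (a :* f :+ x))) refl a b (f zero) _)

  weightedSum-neg : ∀ φ f → weightedSum φ (-ᵛ f) ≈ - weightedSum φ f
  weightedSum-neg []      f = sym -0#≈0#
  weightedSum-neg (a ∷ φ) f = trans (+-cong (sym (-‿distribʳ-* a (f zero))) (weightedSum-neg φ _)) (-‿+-comm _ _)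

  value-cong : ∀ φ {x y} → x ≋ y → value φ x ≈ value φ y
  value-cong φ {x} {y} x≋y = begin
    value φ x                                ≈⟨ value≈weightedSum φ x ⟩
    weightedSum φ (λ i → x i * x i)          ≈⟨ weightedSum-cong φ (λ i → *-cong (x≋y i) (x≋y i)) ⟩
    weightedSum φ (λ i → y i * y i)          ≈⟨ value≈weightedSum φ y ⟨
    value φ y                                ∎

  value-· : ∀ φ a x → value φ (a ·ᵛ x) ≈ (a * a) * value φ x
  value-· φ a x = begin
    value φ (a ·ᵛ x)                                 ≈⟨ value≈weightedSum φ _ ⟩
    weightedSum φ (λ i → (a * x i) * (a * x i))      ≈⟨ weightedSum-cong φ (λ i → *-interchange a (x i) a (x i)) ⟩
    weightedSum φ ((a * a) ·ᵛ (λ i → x i * x i))     ≈⟨ weightedSum-* φ (a * a) _ ⟩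
    (a * a) * weightedSum φ (λ i → x i * x i)        ≈⟨ *-congˡ (value≈weightedSum φ x) ⟨
    (a * a) * value φ x                              ∎

  value-0 : ∀ φ → value φ 0ᵛ ≈ 0#
  value-0 φ = trans (value≈weightedSum φ _) (weightedSum-0 φ (λ i → zeroˡ 0#))

  inl : (α β : Form) → Fin (dim α) → Fin (dim (α ⊥ β))
  inl (a ∷ α) β zero    = zero
  inl (a ∷ α) β (suc i) = suc (inl α β i)

  inr : (α β : Form) → Fin (dim β) → Fin (dim (α ⊥ β))
  inr []      β j = j
  inr (a ∷ α) β j = suc (inr α β j)

  join : (α β : Form) → Vector α → Vector β → Vector (α ⊥ β)
  join []      β u v         = v
  join (a ∷ α) β u v zero    = u zero
  join (a ∷ α) β u v (suc i) = join α β (λ k → u (suc k)) v i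

  projˡ : (α β : Form) → Vector (α ⊥ β) → Vector α
  projˡ α β w = λ i → w (inl α β i)

  projʳ : (α β : Form) → Vector (α ⊥ β) → Vector β
  projʳ α β w = λ j → w (inr α β j)

  projˡ-join : ∀ α β u v → projˡ α β (join α β u v) ≋ u
  projˡ-join (a ∷ α) β u v zero    = refl
  projˡ-join (a ∷ α) β u v (suc i) = projˡ-join α β _ v i

  projʳ-join : ∀ α β u v → projʳ α β (join α β u v) ≋ v
  projʳ-join []      β u v j = refl
  projʳ-join (a ∷ α) β u v j = projʳ-join α β _ v j

  join-proj : ∀ α β w → join α β (projˡ α β w) (projʳ α β w) ≋ w
  join-proj []      β w i       = refl
  join-proj (a ∷ α) β w zero    = refl
  join-proj (a ∷ α) β w (suc i) = join-proj α β (λ k → w (suc k)) i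

  join-cong : ∀ α β {u u′ v v′} → u ≋ u′ → v ≋ v′ → join α β u v ≋ join α β u′ v′
  join-cong []      β u≋u′ v≋v′ i       = v≋v′ i
  join-cong (a ∷ α) β u≋u′ v≋v′ zero    = u≋u′ zero
  join-cong (a ∷ α) β u≋u′ v≋v′ (suc i) = join-cong α β (λ k → u≋u′ (suc k)) v≋v′ i

  join-+ : ∀ α β u v u′ v′ → join α β (u +ᵛ u′) (v +ᵛ v′) ≋ join α β u v +ᵛ join α β u′ v′
  join-+ []      β u v u′ v′ i       = refl
  join-+ (a ∷ α) β u v u′ v′ zero    = refl
  join-+ (a ∷ α) β u v u′ v′ (suc i) = join-+ α β _ v _ v′ i

  join-· : ∀ α β b u v → join α β (b ·ᵛ u) (b ·ᵛ v) ≋ b ·ᵛ join α β u v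
  join-· []      β b u v i       = refl
  join-· (a ∷ α) β b u v zero    = refl
  join-· (a ∷ α) β b u v (suc i) = join-· α β b _ v i

  join-0ᵛ : ∀ α β → join α β 0ᵛ 0ᵛ ≋ 0ᵛ
  join-0ᵛ []      β i       = refl
  join-0ᵛ (a ∷ α) β zero    = refl
  join-0ᵛ (a ∷ α) β (suc i) = join-0ᵛ α β i

  weightedSum-⊥ : ∀ α β f → weightedSum (α ⊥ β) f ≈ weightedSum α (projˡ α β f) + weightedSum β (projʳ α β f)
  weightedSum-⊥ []      β f = sym (+-identityˡ _)
  weightedSum-⊥ (a ∷ α) β f = trans (+-congˡ (weightedSum-⊥ α β _)) (sym (+-assoc _ _ _))

  value-⊥ : ∀ α β w → value (α ⊥ β) w ≈ value α (projˡ α β w) + value β (projʳ α β w)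
  value-⊥ α β w = begin
    value (α ⊥ β) w                                             ≈⟨ value≈weightedSum (α ⊥ β) w ⟩
    weightedSum (α ⊥ β) (λ i → w i * w i)                       ≈⟨ weightedSum-⊥ α β _ ⟩
    weightedSum α (λ i → projˡ α β w i * projˡ α β w i)
      + weightedSum β (λ j → projʳ α β w j * projʳ α β w j)     ≈⟨ +-cong (value≈weightedSum α _) (value≈weightedSum β _) ⟨
    value α (projˡ α β w) + value β (projʳ α β w)               ∎

  value-join : ∀ α β u v → value (α ⊥ β) (join α β u v) ≈ value α u + value β v
  value-join α β u v = trans (value-⊥ α β _) (+-cong (value-cong α (projˡ-join α β u v)) (value-cong β (projʳ-join α β u v)))

  module _ (b : K) (α : Form) where
    private
      dim-scale : dim (scale b α) ≡ dim α
      dim-scale = List.length-map (b *_) α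

    unscale : Vector (scale b α) → Vector α
    unscale y i = y (Fin.cast (≡.sym dim-scale) i)

    rescale : Vector α → Vector (scale b α)
    rescale x i = x (Fin.cast dim-scale i)

    unscale-rescale : ∀ x → unscale (rescale x) ≋ x
    unscale-rescale x i = reflexive (≡.cong x (Fin.cast-involutive dim-scale (≡.sym dim-scale) i))

    rescale-unscale : ∀ y → rescale (unscale y) ≋ y
    rescale-unscale y i = reflexive (≡.cong y (Fin.cast-involutive (≡.sym dim-scale) dim-scale i))

  weightedSum-scale : ∀ b α f → weightedSum (scale b α) f ≈ b * weightedSum α (unscale b α f)
  weightedSum-scale b []      f = sym (zeroʳ b)
  weightedSum-scale b (a ∷ α) f = trans (+-congˡ (weightedSum-scale b α _))
    (solve 4 (λ b a f x → ((b :* a) :* f :+ b :* x) := (b :* (a :* f :+ x))) refl b a (f zero) _)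

  value-scale : ∀ b α y → value (scale b α) y ≈ b * value α (unscale b α y)
  value-scale b α y = begin
    value (scale b α) y                                       ≈⟨ value≈weightedSum (scale b α) y ⟩
    weightedSum (scale b α) (λ i → y i * y i)                 ≈⟨ weightedSum-scale b α _ ⟩
    b * weightedSum α (λ i → unscale b α y i * unscale b α y i) ≈⟨ *-congˡ (value≈weightedSum α _) ⟨
    b * value α (unscale b α y)                               ∎

  value-rescale : ∀ b α x → value (scale b α) (rescale b α x) ≈ b * value α x
  value-rescale b α x = trans (value-scale b α _) (*-congˡ (value-cong α (unscale-rescale b α x)))

  -- Isometries, as linear maps of coordinate vectors rather than as the
  -- matrices of Isometric (see ≅⇒isometric)

  infix 4 _≅_

  record _≅_ (φ ψ : Form) : Set (c ⊔ ℓ) where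
    field
      to        : Vector φ → Vector ψ
      from      : Vector ψ → Vector φ
      to-cong   : ∀ {x y} → x ≋ y → to x ≋ to y
      from-cong : ∀ {x y} → x ≋ y → from x ≋ from y
      to-+      : ∀ x y → to (x +ᵛ y) ≋ to x +ᵛ to y
      to-·      : ∀ a x → to (a ·ᵛ x) ≋ a ·ᵛ to x
      from-to   : ∀ x → from (to x) ≋ x
      to-from   : ∀ y → to (from y) ≋ y
      value-to  : ∀ x → value ψ (to x) ≈ value φ x

    from-+ : ∀ x y → from (x +ᵛ y) ≋ from x +ᵛ from y
    from-+ x y = ≋-trans (from-cong (≋-sym to-sum)) (from-to _)
      where
      to-sum : to (from x +ᵛ from y) ≋ x +ᵛ y
      to-sum = ≋-trans (to-+ _ _) (λ i → +-cong (to-from x i) (to-from y i))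

    from-· : ∀ a x → from (a ·ᵛ x) ≋ a ·ᵛ from x
    from-· a x = ≋-trans (from-cong (≋-sym to-multiple)) (from-to _)
      where
      to-multiple : to (a ·ᵛ from x) ≋ a ·ᵛ x
      to-multiple = ≋-trans (to-· _ _) (λ i → *-congˡ (to-from x i))

  open _≅_ public

  ≅-refl : ∀ {φ} → φ ≅ φ
  ≅-refl = record
    { to = λ x → x ; from = λ x → x ; to-cong = λ p → p ; from-cong = λ p → p
    ; to-+ = λ x y → ≋-refl ; to-· = λ a x → ≋-refl
    ; from-to = λ x → ≋-refl ; to-from = λ x → ≋-refl ; value-to = λ x → refl }

  ≅-sym : ∀ {φ ψ} → φ ≅ ψ → ψ ≅ φ
  ≅-sym {φ} {ψ} I = record
    { to = from I ; from = to I ; to-cong = from-cong I ; from-cong = to-cong I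
    ; to-+ = from-+ I ; to-· = from-· I ; from-to = to-from I ; to-from = from-to I
    ; value-to = λ y → trans (sym (value-to I (from I y))) (value-cong ψ (to-from I y)) }

  ≅-trans : ∀ {φ ψ χ} → φ ≅ ψ → ψ ≅ χ → φ ≅ χ
  ≅-trans I J = record
    { to = λ x → to J (to I x) ; from = λ z → from I (from J z)
    ; to-cong = λ p → to-cong J (to-cong I p) ; from-cong = λ p → from-cong I (from-cong J p)
    ; to-+ = λ x y → ≋-trans (to-cong J (to-+ I x y)) (to-+ J _ _)
    ; to-· = λ a x → ≋-trans (to-cong J (to-· I a x)) (to-· J _ _)
    ; from-to = λ x → ≋-trans (from-cong I (from-to J (to I x))) (from-to I x)
    ; to-from = λ z → ≋-trans (to-cong J (to-from I (from J z))) (to-from J z)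
    ; value-to = λ x → trans (value-to J (to I x)) (value-to I x) }

  ≅-reflexive : ∀ {φ ψ} → φ ≡ ψ → φ ≅ ψ
  ≅-reflexive ≡.refl = ≅-refl

  infixr 2 _≅⟨_⟩_
  infix  3 _≅∎

  _≅⟨_⟩_ : ∀ α {β γ} → α ≅ β → β ≅ γ → α ≅ γ
  α ≅⟨ α≅β ⟩ β≅γ = ≅-trans α≅β β≅γ

  _≅∎ : ∀ α → α ≅ α
  α ≅∎ = ≅-refl

  involution-≅ : ∀ {φ} (s : Vector φ → Vector φ) →
    (∀ {x y} → x ≋ y → s x ≋ s y) → (∀ x y → s (x +ᵛ y) ≋ s x +ᵛ s y) → (∀ a x → s (a ·ᵛ x) ≋ a ·ᵛ s x) →
    (∀ x → s (s x) ≋ x) → (∀ x → value φ (s x) ≈ value φ x) → φ ≅ φ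
  involution-≅ s s-cong s-+ s-· s-s value-s = record
    { to = s ; from = s ; to-cong = s-cong ; from-cong = s-cong ; to-+ = s-+ ; to-· = s-·
    ; from-to = s-s ; to-from = s-s ; value-to = value-s }

  -ᵛ-≅ : ∀ φ → φ ≅ φ
  -ᵛ-≅ φ = involution-≅ -ᵛ_ (λ p i → -‿cong (p i)) (λ x y i → sym (-‿+-comm _ _)) (λ a x i → -‿distribʳ-* _ _)
    (λ x i → -‿involutive _) value-neg
    where
    value-neg : ∀ x → value φ (-ᵛ x) ≈ value φ x
    value-neg x = begin
      value φ (-ᵛ x)              ≈⟨ value-cong φ (λ i → sym (-1*x≈-x _)) ⟩
      value φ ((- 1#) ·ᵛ x)       ≈⟨ value-· φ (- 1#) x ⟩
      (- 1# * - 1#) * value φ x   ≈⟨ *-congʳ (trans (-1*x≈-x (- 1#)) (-‿involutive 1#)) ⟩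
      1# * value φ x              ≈⟨ *-identityˡ _ ⟩
      value φ x                   ∎

  ⊥-cong : ∀ {α α′ β β′} → α ≅ α′ → β ≅ β′ → α ⊥ β ≅ α′ ⊥ β′
  ⊥-cong {α} {α′} {β} {β′} I J = record
    { to = λ w → join α′ β′ (to I (projˡ α β w)) (to J (projʳ α β w))
    ; from = λ w → join α β (from I (projˡ α′ β′ w)) (from J (projʳ α′ β′ w))
    ; to-cong = λ p → join-cong α′ β′ (to-cong I (λ k → p _)) (to-cong J (λ k → p _))
    ; from-cong = λ p → join-cong α β (from-cong I (λ k → p _)) (from-cong J (λ k → p _))
    ; to-+ = λ x y → ≋-trans (join-cong α′ β′ (to-+ I _ _) (to-+ J _ _)) (join-+ α′ β′ _ _ _ _)
    ; to-· = λ a x → ≋-trans (join-cong α′ β′ (to-· I _ _) (to-· J _ _)) (join-· α′ β′ a _ _)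
    ; from-to = λ w → ≋-trans (join-cong α β
        (≋-trans (from-cong I (projˡ-join α′ β′ _ _)) (from-to I _))
        (≋-trans (from-cong J (projʳ-join α′ β′ _ _)) (from-to J _))) (join-proj α β w)
    ; to-from = λ w → ≋-trans (join-cong α′ β′
        (≋-trans (to-cong I (projˡ-join α β _ _)) (to-from I _))
        (≋-trans (to-cong J (projʳ-join α β _ _)) (to-from J _))) (join-proj α′ β′ w)
    ; value-to = λ w → trans (value-join α′ β′ _ _) (trans (+-cong (value-to I _) (value-to J _)) (sym (value-⊥ α β w))) }

  ⊥-comm : ∀ α β → α ⊥ β ≅ β ⊥ α
  ⊥-comm α β = record
    { to = λ w → join β α (projʳ α β w) (projˡ α β w)
    ; from = λ w → join α β (projʳ β α w) (projˡ β α w)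
    ; to-cong = λ p → join-cong β α (λ k → p _) (λ k → p _)
    ; from-cong = λ p → join-cong α β (λ k → p _) (λ k → p _)
    ; to-+ = λ x y → join-+ β α _ _ _ _
    ; to-· = λ a x → join-· β α a _ _
    ; from-to = λ w → ≋-trans (join-cong α β (projʳ-join β α _ _) (projˡ-join β α _ _)) (join-proj α β w)
    ; to-from = λ w → ≋-trans (join-cong β α (projʳ-join α β _ _) (projˡ-join α β _ _)) (join-proj β α w)
    ; value-to = λ w → trans (value-join β α _ _) (trans (+-comm _ _) (sym (value-⊥ α β w))) }

  pointwise-≅ : ∀ {α β} → Pointwise _≈_ α β → α ≅ β
  pointwise-≅ {α} {β} α≈β = record
    { to = λ x i → x (Fin.cast (≡.sym |α|≡|β|) i) ; from = λ y i → y (Fin.cast |α|≡|β| i)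
    ; to-cong = λ p i → p _ ; from-cong = λ p i → p _
    ; to-+ = λ x y i → refl ; to-· = λ a x i → refl
    ; from-to = λ x i → reflexive (≡.cong x (Fin.cast-involutive (≡.sym |α|≡|β|) |α|≡|β| i))
    ; to-from = λ y i → reflexive (≡.cong y (Fin.cast-involutive |α|≡|β| (≡.sym |α|≡|β|) i))
    ; value-to = value-cast α≈β }
    where
    |α|≡|β| = Pointwise-length α≈β
    value-cast : ∀ {α β} (α≈β : Pointwise _≈_ α β) x → value β (λ i → x (Fin.cast (≡.sym (Pointwise-length α≈β)) i)) ≈ value α x
    value-cast []          x = refl
    value-cast (a≈b ∷ α≈β) x = +-cong (*-congʳ (sym a≈b)) (value-cast α≈β (λ i → x (suc i)))

  module ↭ = Permutation setoid
  module ↭-Properties = PermutationProperties setoid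

  ↭⇒≅ : ∀ {α β} → α ↭.↭ β → α ≅ β
  ↭⇒≅ (↭.refl α≈β)           = pointwise-≅ α≈β
  ↭⇒≅ (↭.prep a≈b α↭β)       = ⊥-cong (pointwise-≅ (a≈b ∷ [])) (↭⇒≅ α↭β)
  ↭⇒≅ (↭.swap {x = a} {y = b} a≈a′ b≈b′ α↭β) =
    ⊥-cong (≅-trans (⊥-comm (a ∷ []) (b ∷ [])) (pointwise-≅ (b≈b′ ∷ a≈a′ ∷ []))) (↭⇒≅ α↭β)
  ↭⇒≅ (↭.trans α↭β β↭γ)      = ≅-trans (↭⇒≅ α↭β) (↭⇒≅ β↭γ)

  scale-cong : ∀ b {α β} → α ≅ β → scale b α ≅ scale b β
  scale-cong b {α} {β} I = record
    { to = λ y → rescale b β (to I (unscale b α y))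
    ; from = λ y → rescale b α (from I (unscale b β y))
    ; to-cong = λ p i → to-cong I (λ k → p _) _
    ; from-cong = λ p i → from-cong I (λ k → p _) _
    ; to-+ = λ x y i → to-+ I _ _ _
    ; to-· = λ a x i → to-· I _ _ _
    ; from-to = λ y i → trans (from-cong I (unscale-rescale b β _) _) (trans (from-to I _ _) (rescale-unscale b α y i))
    ; to-from = λ y i → trans (to-cong I (unscale-rescale b α _) _) (trans (to-from I _ _) (rescale-unscale b β y i))
    ; value-to = λ y → begin
        value (scale b β) (rescale b β (to I (unscale b α y)))  ≈⟨ value-rescale b β _ ⟩
        b * value β (to I (unscale b α y))                     ≈⟨ *-congˡ (value-to I _) ⟩
        b * value α (unscale b α y)                            ≈⟨ value-scale b α y ⟨
        value (scale b α) y                                    ∎ }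

  square-scale-≅ : ∀ {s} α → Nonzero s → scale (s * s) α ≅ α
  square-scale-≅ {s} α s≉0 = record
    { to = λ y → s ·ᵛ unscale (s * s) α y
    ; from = λ x → rescale (s * s) α (s⁻¹ ·ᵛ x)
    ; to-cong = λ p i → *-congˡ (p _) ; from-cong = λ p i → *-congˡ (p _)
    ; to-+ = λ x y i → distribˡ _ _ _ ; to-· = λ a x i → x∙yz≈y∙xz s a _
    ; from-to = λ y i → trans (*-congˡ (*-congˡ (rescale-unscale (s * s) α y i))) (cancel (*-inverseˡ s s≉0))
    ; to-from = λ x i → trans (*-congˡ (*-congˡ (unscale-rescale (s * s) α x i))) (cancel (*-inverseʳ s s≉0))
    ; value-to = λ y → trans (value-· α s _) (sym (value-scale (s * s) α y)) }
    where
    s⁻¹ = s ⁻¹⟨ s≉0 ⟩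
    cancel : ∀ {a b y} → a * b ≈ 1# → a * (b * y) ≈ y
    cancel ab≈1 = trans (sym (*-assoc _ _ _)) (trans (*-congʳ ab≈1) (*-identityˡ _))

  map-pointwise : ∀ {f g : K → K} α → (∀ a → f a ≈ g a) → Pointwise _≈_ (map f α) (map g α)
  map-pointwise []      f≈g = []
  map-pointwise (a ∷ α) f≈g = f≈g a ∷ map-pointwise α f≈g

  scale-≈ : ∀ {a b} α → a ≈ b → scale a α ≅ scale b α
  scale-≈ α a≈b = pointwise-≅ (map-pointwise α (λ k → *-congʳ a≈b))

  scale-scale : ∀ a b α → scale a (scale b α) ≅ scale (a * b) α
  scale-scale a b α = ≅-trans (≅-reflexive (≡.sym (List.map-∘ α))) (pointwise-≅ (map-pointwise α (λ k → sym (*-assoc a b k))))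

  scale-1# : ∀ α → scale 1# α ≅ α
  scale-1# α = ≅-trans (pointwise-≅ (map-pointwise α *-identityˡ)) (≅-reflexive (List.map-id α))

  scale-⊥ : ∀ a α β → scale a (α ⊥ β) ≅ scale a α ⊥ scale a β
  scale-⊥ a α β = ≅-reflexive (List.map-++ (a *_) α β)

  scale-≅-cancelˡ : ∀ {a b α β} (a≉0 : Nonzero a) → scale a α ≅ scale b β → α ≅ scale (a ⁻¹⟨ a≉0 ⟩ * b) β
  scale-≅-cancelˡ {a} {b} {α} {β} a≉0 aα≅bβ =
    α                              ≅⟨ ≅-sym (scale-1# α) ⟩
    scale 1# α                     ≅⟨ scale-≈ α (sym (*-inverseˡ a a≉0)) ⟩
    scale (a⁻¹ * a) α              ≅⟨ ≅-sym (scale-scale a⁻¹ a α) ⟩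
    scale a⁻¹ (scale a α)          ≅⟨ scale-cong a⁻¹ aα≅bβ ⟩
    scale a⁻¹ (scale b β)          ≅⟨ scale-scale a⁻¹ b β ⟩
    scale (a⁻¹ * b) β              ≅∎
    where a⁻¹ = a ⁻¹⟨ a≉0 ⟩

  value-binary : ∀ c d (v : Fin 2 → K) → value (c ∷ d ∷ []) v ≈ c * (v zero * v zero) + d * (v (suc zero) * v (suc zero))
  value-binary c d v = +-congˡ (+-identityʳ _)

  -- With w = (A + B)⁻¹ the substitution is X = w (A x + B y), Y = w (x − y).
  binary-≅ : ∀ {A B} → Nonzero (A + B) → (A ∷ B ∷ []) ≅ (A + B ∷ (A + B) * (A * B) ∷ [])
  binary-≅ {A} {B} A+B≉0 = record
    { to = to₂
    ; from = λ v → pair (v zero + B * v (suc zero)) (v zero - A * v (suc zero))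
    ; to-cong = λ p → ext₂ (*-congˡ (+-cong (*-congˡ (p zero)) (*-congˡ (p (suc zero)))))
                                (*-congˡ (+-cong (p zero) (-‿cong (p (suc zero)))))
    ; from-cong = λ p → ext₂ (+-cong (p zero) (*-congˡ (p (suc zero))))
                                  (+-cong (p zero) (-‿cong (*-congˡ (p (suc zero)))))
    ; to-+ = λ x y → ext₂
        (solve 7 (λ w A B x y x′ y′ → (w :* (A :* (x :+ x′) :+ B :* (y :+ y′)))
                                      := (w :* (A :* x :+ B :* y) :+ w :* (A :* x′ :+ B :* y′))) refl w A B _ _ _ _)
        (solve 5 (λ w x y x′ y′ → (w :* ((x :+ x′) :- (y :+ y′))) := (w :* (x :- y) :+ w :* (x′ :- y′))) refl w _ _ _ _)
    ; to-· = λ a x → ext₂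
        (solve 6 (λ w A B a x y → (w :* (A :* (a :* x) :+ B :* (a :* y))) := (a :* (w :* (A :* x :+ B :* y)))) refl w A B a _ _)
        (solve 4 (λ w a x y → (w :* (a :* x :- a :* y)) := (a :* (w :* (x :- y)))) refl w a _ _)
    ; from-to = λ v → ext₂
        (trans (solve 5 (λ w A B x y → (w :* (A :* x :+ B :* y) :+ B :* (w :* (x :- y))) := ((w :* (A :+ B)) :* x)) refl w A B _ _) (cancel _))
        (trans (solve 5 (λ w A B x y → (w :* (A :* x :+ B :* y) :- A :* (w :* (x :- y))) := ((w :* (A :+ B)) :* y)) refl w A B _ _) (cancel _))
    ; to-from = λ v → ext₂
        (trans (solve 5 (λ w A B X Y → (w :* (A :* (X :+ B :* Y) :+ B :* (X :- A :* Y))) := ((w :* (A :+ B)) :* X)) refl w A B _ _) (cancel _))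
        (trans (solve 5 (λ w A B X Y → (w :* ((X :+ B :* Y) :- (X :- A :* Y))) := ((w :* (A :+ B)) :* Y)) refl w A B _ _) (cancel _))
    ; value-to = λ v → begin
        value (A + B ∷ (A + B) * (A * B) ∷ []) (to₂ v)
          ≈⟨ value-binary _ _ (to₂ v) ⟩
        (A + B) * sq (w * (A * v zero + B * v (suc zero))) + ((A + B) * (A * B)) * sq (w * (v zero - v (suc zero)))
          ≈⟨ solve 5 (λ w A B x y → ((A :+ B) :* ((w :* (A :* x :+ B :* y)) :* (w :* (A :* x :+ B :* y)))
                                     :+ ((A :+ B) :* (A :* B)) :* ((w :* (x :- y)) :* (w :* (x :- y))))
                                   := ((w :* (A :+ B)) :* ((w :* (A :+ B)) :* (A :* (x :* x) :+ B :* (y :* y)))))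
                     refl w A B (v zero) (v (suc zero)) ⟩
        (w * (A + B)) * ((w * (A + B)) * (A * sq (v zero) + B * sq (v (suc zero))))
          ≈⟨ trans (cancel _) (cancel _) ⟩
        A * sq (v zero) + B * sq (v (suc zero))
          ≈⟨ value-binary A B v ⟨
        value (A ∷ B ∷ []) v ∎ }
    where
    w = (A + B) ⁻¹⟨ A+B≉0 ⟩
    sq : K → K
    sq x = x * x
    pair : K → K → Fin 2 → K
    pair x y zero       = x
    pair x y (suc zero) = y
    to₂ : (Fin 2 → K) → Fin 2 → K
    to₂ v = pair (w * (A * v zero + B * v (suc zero))) (w * (v zero - v (suc zero)))
    ext₂ : ∀ {u v : Fin 2 → K} → u zero ≈ v zero → u (suc zero) ≈ v (suc zero) → u ≋ v
    ext₂ u₀≈v₀ u₁≈v₁ zero       = u₀≈v₀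
    ext₂ u₀≈v₀ u₁≈v₁ (suc zero) = u₁≈v₁
    cancel : ∀ x → (w * (A + B)) * x ≈ x
    cancel x = trans (*-congʳ (*-inverseˡ (A + B) A+B≉0)) (*-identityˡ x)

  binary-⊗-cong : ∀ {A B C D} ρ → (A ∷ B ∷ []) ≅ (C ∷ D ∷ []) → scale A ρ ⊥ scale B ρ ≅ scale C ρ ⊥ scale D ρ
  binary-⊗-cong         []      I = ≅-refl
  binary-⊗-cong {A} {B} {C} {D} (a ∷ ρ) I =
    (A * a ∷ scale A ρ) ⊥ (B * a ∷ scale B ρ)        ≅⟨ ↭⇒≅ (↭.prep refl (↭-Properties.↭-shift (scale A ρ) (scale B ρ))) ⟩
    (A * a ∷ B * a ∷ []) ⊥ (scale A ρ ⊥ scale B ρ)   ≅⟨ ⊥-cong (scaled I) (binary-⊗-cong ρ I) ⟩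
    (C * a ∷ D * a ∷ []) ⊥ (scale C ρ ⊥ scale D ρ)   ≅⟨ ≅-sym (↭⇒≅ (↭.prep refl (↭-Properties.↭-shift (scale C ρ) (scale D ρ)))) ⟩
    (C * a ∷ scale C ρ) ⊥ (D * a ∷ scale D ρ)        ≅∎
    where
    commute : ∀ x y → (x * a ∷ y * a ∷ []) ≅ scale a (x ∷ y ∷ [])
    commute x y = pointwise-≅ (*-comm x a ∷ *-comm y a ∷ [])
    scaled : (A ∷ B ∷ []) ≅ (C ∷ D ∷ []) → (A * a ∷ B * a ∷ []) ≅ (C * a ∷ D * a ∷ [])
    scaled I = ≅-trans (commute A B) (≅-trans (scale-cong a I) (≅-sym (commute C D)))

  -- Round forms; Pfister forms are round

  Represents : Form → K → Set (c ⊔ ℓ)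
  Represents φ a = Σ (Vector φ) λ u → value φ u ≈ a

  Round : Form → Set (c ⊔ ℓ)
  Round φ = ∀ {a} → Nonzero a → Represents φ a → scale a φ ≅ φ

  represents-≅ : ∀ {φ ψ a} → φ ≅ ψ → Represents φ a → Represents ψ a
  represents-≅ φ≅ψ (u , φu≈a) = to φ≅ψ u , trans (value-to φ≅ψ u) φu≈a

  represents-scale : ∀ {ρ b} a → Represents ρ b → Represents (scale a ρ) (a * b)
  represents-scale {ρ} a (u , ρu≈b) = rescale a ρ u , trans (value-rescale a ρ u) (*-congˡ ρu≈b)

  round-represents-* : ∀ {ρ a b} → Round ρ → Nonzero a → Represents ρ a → Represents ρ b → Represents ρ (a * b)
  round-represents-* {ρ} {a} ρ-round a≉0 ρa ρb = represents-≅ (ρ-round a≉0 ρa) (represents-scale {ρ} a ρb)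

  scale-similar : ∀ {a b c} ρ → a ≈ b * c → scale c ρ ≅ ρ → scale a ρ ≅ scale b ρ
  scale-similar {a} {b} {c} ρ a≈bc cρ≅ρ =
    scale a ρ              ≅⟨ scale-≈ ρ a≈bc ⟩
    scale (b * c) ρ        ≅⟨ ≅-sym (scale-scale b c ρ) ⟩
    scale b (scale c ρ)    ≅⟨ scale-cong b cρ≅ρ ⟩
    scale b ρ              ≅∎

  ⟨1⟩-round : Round (1# ∷ [])
  ⟨1⟩-round {a} a≉0 (u , value≈a) =
    scale a (1# ∷ [])                   ≅⟨ scale-≈ (1# ∷ []) a≈u₀² ⟩
    scale (u zero * u zero) (1# ∷ [])   ≅⟨ square-scale-≅ (1# ∷ []) (nonzero-factorʳ (nonzero-cong a≈u₀² a≉0)) ⟩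
    1# ∷ []                             ≅∎
    where
    a≈u₀² : a ≈ u zero * u zero
    a≈u₀² = trans (sym value≈a) (trans (+-identityʳ _) (*-identityˡ _))

  -- The case A, B ≉ 0 is the binary identity ⟨A, B⟩ ≅ ⟨A + B, (A + B) A B⟩,
  -- with A B = b · (A C) a similarity factor of ρ.
  round-⊥-scale : ∀ {ρ b} → Round ρ → Nonzero b → Round (ρ ⊥ scale b ρ)
  round-⊥-scale {ρ} {b} ρ-round b≉0 {w} w≉0 (u , value≈w) = by-cases (≈0? A) (≈0? B)
    where
    u₁ = projˡ ρ (scale b ρ) u
    u₂ = unscale b ρ (projʳ ρ (scale b ρ) u)
    A = value ρ u₁
    C = value ρ u₂
    B = b * C
    w≈A+B : w ≈ A + B
    w≈A+B = trans (sym value≈w) (trans (value-⊥ ρ (scale b ρ) u) (+-congˡ (value-scale b ρ _)))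
    by-cases : Dec (A ≈ 0#) → Dec (B ≈ 0#) → scale w (ρ ⊥ scale b ρ) ≅ ρ ⊥ scale b ρ
    by-cases (yes A≈0) _ =
      scale w (ρ ⊥ scale b ρ)            ≅⟨ scale-⊥ w ρ (scale b ρ) ⟩
      scale w ρ ⊥ scale w (scale b ρ)    ≅⟨ ⊥-cong (scale-similar ρ w≈bC Cρ≅ρ) (scale-scale w b ρ) ⟩
      scale b ρ ⊥ scale (w * b) ρ        ≅⟨ ⊥-cong ≅-refl (scale-similar ρ wb≈b²C Cρ≅ρ) ⟩
      scale b ρ ⊥ scale (b * b) ρ        ≅⟨ ⊥-cong ≅-refl (square-scale-≅ ρ b≉0) ⟩
      scale b ρ ⊥ ρ                      ≅⟨ ⊥-comm (scale b ρ) ρ ⟩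
      ρ ⊥ scale b ρ                      ≅∎
      where
      w≈bC : w ≈ b * C
      w≈bC = trans w≈A+B (trans (+-congʳ A≈0) (+-identityˡ _))
      wb≈b²C : w * b ≈ (b * b) * C
      wb≈b²C = trans (*-congʳ w≈bC) (solve 2 (λ b C → ((b :* C) :* b) := ((b :* b) :* C)) refl b C)
      Cρ≅ρ = ρ-round (nonzero-factorʳ (nonzero-cong w≈bC w≉0)) (u₂ , refl)
    by-cases (no A≉0) (yes B≈0) =
      scale w (ρ ⊥ scale b ρ)            ≅⟨ scale-⊥ w ρ (scale b ρ) ⟩
      scale w ρ ⊥ scale w (scale b ρ)    ≅⟨ ⊥-cong (≅-trans (scale-≈ ρ w≈A) Aρ≅ρ) (scale-scale w b ρ) ⟩
      ρ ⊥ scale (w * b) ρ                ≅⟨ ⊥-cong ≅-refl (scale-similar ρ wb≈bA Aρ≅ρ) ⟩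
      ρ ⊥ scale b ρ                      ≅∎
      where
      w≈A : w ≈ A
      w≈A = trans w≈A+B (trans (+-congˡ B≈0) (+-identityʳ _))
      wb≈bA : w * b ≈ b * A
      wb≈bA = trans (*-congʳ w≈A) (*-comm A b)
      Aρ≅ρ = ρ-round A≉0 (u₁ , refl)
    by-cases (no A≉0) (no B≉0) =
      scale w (ρ ⊥ scale b ρ)                        ≅⟨ scale-⊥ w ρ (scale b ρ) ⟩
      scale w ρ ⊥ scale w (scale b ρ)                ≅⟨ ⊥-cong (scale-≈ ρ w≈A+B) (scale-scale w b ρ) ⟩
      scale (A + B) ρ ⊥ scale (w * b) ρ              ≅⟨ ⊥-cong ≅-refl (≅-sym (scale-similar ρ [A+B]AB≈wb·AC ACρ≅ρ)) ⟩
      scale (A + B) ρ ⊥ scale ((A + B) * (A * B)) ρ  ≅⟨ ≅-sym (binary-⊗-cong ρ (binary-≅ (nonzero-cong w≈A+B w≉0))) ⟩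
      scale A ρ ⊥ scale (b * C) ρ                    ≅⟨ ⊥-cong Aρ≅ρ (scale-similar ρ refl Cρ≅ρ) ⟩
      ρ ⊥ scale b ρ                                  ≅∎
      where
      C≉0 : Nonzero C
      C≉0 = nonzero-factorʳ B≉0
      Aρ≅ρ = ρ-round A≉0 (u₁ , refl)
      Cρ≅ρ = ρ-round C≉0 (u₂ , refl)
      ACρ≅ρ = ρ-round (*-nonzero A≉0 C≉0) (round-represents-* ρ-round A≉0 (u₁ , refl) (u₂ , refl))
      [A+B]AB≈wb·AC : (A + B) * (A * B) ≈ (w * b) * (A * C)
      [A+B]AB≈wb·AC = trans (*-congʳ (sym w≈A+B))
        (solve 4 (λ w A b C → (w :* (A :* (b :* C))) := ((w :* b) :* (A :* C))) refl w A b C)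

  pfister-round : ∀ n a → (∀ i → Nonzero (a i)) → Round (pfister n a)
  pfister-round zero    a a≉0 = ⟨1⟩-round
  pfister-round (suc n) a a≉0 =
    round-⊥-scale (pfister-round n (λ i → a (suc i)) (λ i → a≉0 (suc i))) (-‿nonzero (a≉0 zero))

  dim-pfister : ∀ n a → dim (pfister n a) ≡ 2 ^ n
  dim-pfister zero    a = ≡.refl
  dim-pfister (suc n) a = ≡.trans (List.length-++ ρ)
    (≡.cong₂ ℕ._+_ (dim-pfister n _) (≡.trans (List.length-map _ ρ) (≡.trans (dim-pfister n _) (≡.sym (ℕ.+-identityʳ _)))))
    where ρ = pfister n (λ i → a (suc i))

  pfister-nondegenerate : ∀ n a → (∀ i → Nonzero (a i)) → Nondegenerate (pfister n a)
  pfister-nondegenerate zero    a a≉0 = 1≉0 ∷ []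
  pfister-nondegenerate (suc n) a a≉0 = All.++⁺ ρ≉0 (All.map⁺ (All.map (*-nonzero (-‿nonzero (a≉0 zero))) ρ≉0))
    where ρ≉0 = pfister-nondegenerate n (λ i → a (suc i)) (λ i → a≉0 (suc i))

  round-represents-/ : ∀ {ρ A C t} → Round ρ → Nonzero C → Represents ρ A → Represents ρ C → A ≈ t * C → Represents ρ t
  round-represents-/ {ρ} {A} {C} {t} ρ-round C≉0 ρA ρC A≈tC with round-represents-* ρ-round C≉0 ρC ρA
  ... | u , ρu≈CA = C⁻¹ ·ᵛ u , (begin
    value ρ (C⁻¹ ·ᵛ u)                  ≈⟨ value-· ρ C⁻¹ u ⟩
    (C⁻¹ * C⁻¹) * value ρ u             ≈⟨ *-congˡ (trans ρu≈CA (*-congˡ A≈tC)) ⟩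
    (C⁻¹ * C⁻¹) * (C * (t * C))         ≈⟨ solve 3 (λ i c t → ((i :* i) :* (c :* (t :* c))) := (((i :* c) :* (i :* c)) :* t)) refl C⁻¹ C t ⟩
    ((C⁻¹ * C) * (C⁻¹ * C)) * t         ≈⟨ *-congʳ (*-cong (*-inverseˡ C C≉0) (*-inverseˡ C C≉0)) ⟩
    (1# * 1#) * t                       ≈⟨ trans (*-congʳ (*-identityˡ 1#)) (*-identityˡ t) ⟩
    t                                   ∎)
    where C⁻¹ = C ⁻¹⟨ C≉0 ⟩

  pfister-represents-1 : ∀ n a → Represents (pfister n a) 1#
  pfister-represents-1 zero    a = (λ _ → 1#) , trans (+-identityʳ _) (trans (*-identityˡ _) (*-identityˡ _))
  pfister-represents-1 (suc n) a with pfister-represents-1 n (λ i → a (suc i))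
  ... | u , ρu≈1 = join ρ (scale (- a zero) ρ) u 0ᵛ ,
    trans (value-join ρ _ u 0ᵛ) (trans (+-cong ρu≈1 (value-0 (scale (- a zero) ρ))) (+-identityʳ 1#))
    where ρ = pfister n (λ i → a (suc i))

  scale-represents-1⇒≅ : ∀ {ψ a} → Round ψ → Represents (scale a ψ) 1# → scale a ψ ≅ ψ
  scale-represents-1⇒≅ {ψ} {a} ψ-round (u , aψu≈1) =
    scale a ψ     ≅⟨ ≅-sym (scale-similar ψ 1≈aw (ψ-round w≉0 (unscale a ψ u , refl))) ⟩
    scale 1# ψ    ≅⟨ scale-1# ψ ⟩
    ψ             ≅∎
    where
    w = value ψ (unscale a ψ u)
    1≈aw : 1# ≈ a * w
    1≈aw = trans (sym aψu≈1) (value-scale a ψ u)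
    w≉0 : Nonzero w
    w≉0 = nonzero-factorʳ (nonzero-cong 1≈aw 1≉0)

  scale-≅⇒quotient : ∀ {ρ a b} → scale a ρ ≅ scale b ρ → Represents ρ 1# → Σ K λ y → Represents ρ y × a ≈ b * y
  scale-≅⇒quotient {ρ} {a} {b} I (u , ρu≈1) = value ρ (unscale b ρ v) , (unscale b ρ v , refl) , (begin
    a                          ≈⟨ *-identityʳ a ⟨
    a * 1#                     ≈⟨ *-congˡ ρu≈1 ⟨
    a * value ρ u              ≈⟨ value-rescale a ρ u ⟨
    value (scale a ρ) (rescale a ρ u) ≈⟨ value-to I _ ⟨
    value (scale b ρ) v        ≈⟨ value-scale b ρ v ⟩
    b * value ρ (unscale b ρ v) ∎)
    where v = to I (rescale a ρ u)

  -- Matrices and dimension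

  apply-cong : ∀ {m n} (M : Fin m → Fin n → K) {x y} → x ≋ y → apply M x ≋ apply M y
  apply-cong {n = n} M x≋y i = sumFin-cong n (λ j → *-congˡ (x≋y j))

  apply-+ : ∀ {m n} (M : Fin m → Fin n → K) x y → apply M (x +ᵛ y) ≋ apply M x +ᵛ apply M y
  apply-+ {n = n} M x y i = trans (sumFin-cong n (λ j → distribˡ _ _ _)) (sumFin-+ n _ _)

  apply-· : ∀ {m n} (M : Fin m → Fin n → K) a x → apply M (a ·ᵛ x) ≋ a ·ᵛ apply M x
  apply-· {n = n} M a x i = trans (sumFin-cong n (λ j → x∙yz≈y∙xz (M i j) a (x j))) (sumFin-* n a _)

  apply-0 : ∀ {m n} (M : Fin m → Fin n → K) → apply M 0ᵛ ≋ 0ᵛ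
  apply-0 {n = n} M i = sumFin-0 n (λ j → zeroʳ _)

  isometric⇒≅ : ∀ {φ ψ} → Isometric φ ψ → φ ≅ ψ
  isometric⇒≅ (T , S , ST≋id , TS≋id , value-T) = record
    { to = apply T ; from = apply S ; to-cong = apply-cong T ; from-cong = apply-cong S
    ; to-+ = apply-+ T ; to-· = apply-· T ; from-to = ST≋id ; to-from = TS≋id ; value-to = value-T }

  unit : ∀ {n} → Fin n → Fin n → K
  unit zero    zero    = 1#
  unit zero    (suc i) = 0#
  unit (suc j) zero    = 0#
  unit (suc j) (suc i) = unit j i

  sumFin-unit : ∀ n (f : Fin n → K) i → sumFin n (λ j → f j * unit j i) ≈ f i
  sumFin-unit (suc n) f zero = begin
    f zero * 1# + sumFin n (λ j → f (suc j) * 0#)   ≈⟨ +-cong (*-identityʳ _) (sumFin-0 n (λ j → zeroʳ _)) ⟩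
    f zero + 0#                                      ≈⟨ +-identityʳ _ ⟩
    f zero                                           ∎
  sumFin-unit (suc n) f (suc i) = begin
    f zero * 0# + sumFin n (λ j → f (suc j) * unit j i)   ≈⟨ +-cong (zeroʳ _) (sumFin-unit n (λ j → f (suc j)) i) ⟩
    0# + f (suc i)                                         ≈⟨ +-identityˡ _ ⟩
    f (suc i)                                              ∎

  module LinearMap {n m} (h : (Fin n → K) → (Fin m → K)) (h-cong : ∀ {x y} → x ≋ y → h x ≋ h y)
                   (h-+ : ∀ x y → h (x +ᵛ y) ≋ h x +ᵛ h y) (h-· : ∀ a x → h (a ·ᵛ x) ≋ a ·ᵛ h x) where

    matrix : Fin m → Fin n → K
    matrix i j = h (unit j) i

    private
      Σᵛ : ∀ {d} k → (Fin k → Fin d → K) → Fin d → K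
      Σᵛ k G i = sumFin k (λ j → G j i)

      h-0 : h 0ᵛ ≋ 0ᵛ
      h-0 i = trans (h-cong (λ k → sym (zeroˡ 0#)) i) (trans (h-· 0# 0ᵛ i) (zeroˡ _))

      h-Σ : ∀ k G → h (Σᵛ k G) ≋ Σᵛ k (λ j → h (G j))
      h-Σ zero    G   = h-0
      h-Σ (suc k) G i = trans (h-+ (G zero) (Σᵛ k (λ j → G (suc j))) i) (+-congˡ (h-Σ k (λ j → G (suc j)) i))

    apply-matrix : ∀ x → apply matrix x ≋ h x
    apply-matrix x i = sym (begin
      h x i                                    ≈⟨ h-cong (λ k → sym (sumFin-unit n x k)) i ⟩
      h (Σᵛ n (λ j → x j ·ᵛ unit j)) i         ≈⟨ h-Σ n (λ j → x j ·ᵛ unit j) i ⟩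
      sumFin n (λ j → h (x j ·ᵛ unit j) i)     ≈⟨ sumFin-cong n (λ j → trans (h-· (x j) (unit j) i) (*-comm _ _)) ⟩
      sumFin n (λ j → h (unit j) i * x j)      ∎)

  ≅⇒isometric : ∀ {φ ψ} → φ ≅ ψ → Isometric φ ψ
  ≅⇒isometric {φ} {ψ} I = T.matrix , S.matrix
    , (λ x i → trans (apply-cong S.matrix (T.apply-matrix x) i) (trans (S.apply-matrix (to I x) i) (from-to I x i)))
    , (λ y i → trans (apply-cong T.matrix (S.apply-matrix y) i) (trans (T.apply-matrix (from I y) i) (to-from I y i)))
    , (λ x → trans (value-cong ψ (T.apply-matrix x)) (value-to I x))
    where
    module T = LinearMap (to I) (to-cong I) (to-+ I) (to-· I)
    module S = LinearMap (from I) (from-cong I) (from-+ I) (from-· I)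

  zero-or-pivot : ∀ {p} (r : Fin p → K) → r ≋ 0ᵛ ⊎ ∃ λ j → Nonzero (r j)
  zero-or-pivot {zero}  r = inj₁ (λ ())
  zero-or-pivot {suc p} r with ≈0? (r zero) | zero-or-pivot (λ j → r (suc j))
  ... | no r₀≉0 | _                = inj₂ (zero , r₀≉0)
  ... | yes _   | inj₂ (j , rⱼ≉0)  = inj₂ (suc j , rⱼ≉0)
  ... | yes r₀≈0 | inj₁ r≋0        = inj₁ λ { zero → r₀≈0 ; (suc j) → r≋0 j }

  NontrivialKernel : ∀ {q p} → (Fin q → Fin p → K) → Set (c ⊔ ℓ)
  NontrivialKernel {p = p} M = Σ (Fin p → K) λ v → (∃ λ j → Nonzero (v j)) × apply M v ≋ 0ᵛ

  module PivotElimination {q p} (M : Fin (suc q) → Fin (suc p) → K) (j : Fin (suc p)) (rⱼ≉0 : Nonzero (M zero j)) where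
    private
      r = M zero

    factor : Fin p → K
    factor k = r (punchIn j k) * r j ⁻¹⟨ rⱼ≉0 ⟩

    reduced : Fin q → Fin p → K
    reduced i k = M (suc i) (punchIn j k) - factor k * M (suc i) j

    -- Solve the first equation for the j-th unknown.
    extend-kernel : NontrivialKernel reduced → NontrivialKernel M
    extend-kernel (μ , (k , μₖ≉0) , reducedμ≋0) =
      v , (punchIn j k , nonzero-cong (reflexive (≡.sym (insertAt-punchIn μ j t k))) μₖ≉0) , rows
      where
      t = - sumFin p (λ k → factor k * μ k)
      v = insertAt μ j t
      expand : ∀ row → sumFin (suc p) (λ j′ → row j′ * v j′) ≈ row j * t + sumFin p (λ k → row (punchIn j k) * μ k)
      expand row = trans (sumFin-punchIn p j (λ j′ → row j′ * v j′))
        (+-cong (*-congˡ (reflexive (insertAt-lookup μ j t))) (sumFin-cong p (λ k → *-congˡ (reflexive (insertAt-punchIn μ j t k)))))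
      cancel-pivot : ∀ a m → r j * ((a * r j ⁻¹⟨ rⱼ≉0 ⟩) * m) ≈ a * m
      cancel-pivot a m = trans (solve 4 (λ x a y m → (x :* ((a :* y) :* m)) := ((x :* y) :* (a :* m))) refl (r j) a _ m)
        (trans (*-congʳ (*-inverseʳ (r j) rⱼ≉0)) (*-identityˡ _))
      rows : apply M v ≋ 0ᵛ
      rows zero = trans (expand r) (begin
        r j * t + sumFin p (λ k → r (punchIn j k) * μ k)
          ≈⟨ +-congʳ (trans (sym (-‿distribʳ-* _ _)) (-‿cong (sym (sumFin-* p (r j) _)))) ⟩
        - sumFin p (λ k → r j * (factor k * μ k)) + sumFin p (λ k → r (punchIn j k) * μ k)
          ≈⟨ +-congʳ (-‿cong (sumFin-cong p (λ k → cancel-pivot (r (punchIn j k)) (μ k)))) ⟩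
        - sumFin p (λ k → r (punchIn j k) * μ k) + sumFin p (λ k → r (punchIn j k) * μ k)
          ≈⟨ -‿inverseˡ _ ⟩
        0# ∎)
      rows (suc i) = trans (expand (M (suc i))) (begin
        M (suc i) j * t + sumFin p (λ k → M (suc i) (punchIn j k) * μ k)
          ≈⟨ +-comm _ _ ⟩
        sumFin p (λ k → M (suc i) (punchIn j k) * μ k) + M (suc i) j * t
          ≈⟨ +-congˡ (trans (sym (-‿distribʳ-* _ _)) (trans (-‿cong (sym (sumFin-* p _ _))) (sym (sumFin-neg p _)))) ⟩
        sumFin p (λ k → M (suc i) (punchIn j k) * μ k) + sumFin p (λ k → - (M (suc i) j * (factor k * μ k)))
          ≈⟨ sumFin-+ p _ _ ⟨
        sumFin p (λ k → M (suc i) (punchIn j k) * μ k + - (M (suc i) j * (factor k * μ k)))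
          ≈⟨ sumFin-cong p (λ k → solve 4 (λ b m a u → (b :* u :+ :- (m :* (a :* u))) := ((b :- a :* m) :* u)) refl _ _ _ (μ k)) ⟩
        sumFin p (λ k → reduced i k * μ k)
          ≈⟨ reducedμ≋0 i ⟩
        0# ∎)

  wide-matrix-kernel : ∀ {q p} → q ℕ.< p → (M : Fin q → Fin p → K) → NontrivialKernel M
  wide-matrix-kernel {zero}  {suc p} q<p M = (λ _ → 1#) , (zero , 1≉0) , (λ ())
  wide-matrix-kernel {suc q} {suc p} (s≤s q<p) M with zero-or-pivot (M zero)
  ... | inj₂ (j , rⱼ≉0) = extend-kernel (wide-matrix-kernel q<p reduced)
    where open PivotElimination M j rⱼ≉0
  ... | inj₁ r≋0 with wide-matrix-kernel (ℕ.m<n⇒m<1+n q<p) (λ i → M (suc i))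
  ...   | v , v≉0 , rest≋0 = v , v≉0 , λ
          { zero    → sumFin-0 (suc p) {λ j → M zero j * v j} (λ j → trans (*-congʳ (r≋0 j)) (zeroˡ _))
          ; (suc i) → rest≋0 i }

  left-invertible⇒≤ : ∀ {p q} (T : Fin q → Fin p → K) (S : Fin p → Fin q → K) →
    (∀ x → apply S (apply T x) ≋ x) → p ℕ.≤ q
  left-invertible⇒≤ {p} {q} T S ST≋id with p ℕ.≤? q
  ... | yes p≤q = p≤q
  ... | no p≰q  = ⊥-elim (vⱼ≉0 (begin
      v j                     ≈⟨ ST≋id v j ⟨
      apply S (apply T v) j   ≈⟨ apply-cong S Tv≋0 j ⟩
      apply S 0ᵛ j            ≈⟨ apply-0 S j ⟩
      0#                      ∎))
    where
    K′ = wide-matrix-kernel (ℕ.≰⇒> p≰q) T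
    v = proj₁ K′
    j = proj₁ (proj₁ (proj₂ K′))
    vⱼ≉0 = proj₂ (proj₁ (proj₂ K′))
    Tv≋0 = proj₂ (proj₂ K′)

  ≅-dim : ∀ {φ ψ} → φ ≅ ψ → dim φ ≡ dim ψ
  ≅-dim I with ≅⇒isometric I
  ... | T , S , ST≋id , TS≋id , _ = ℕ.≤-antisym (left-invertible⇒≤ T S ST≋id) (left-invertible⇒≤ S T TS≋id)

  -- Witt cancellation

  polar : (φ : Form) → Vector φ → Vector φ → K
  polar φ x y = weightedSum φ (λ i → x i * y i)

  polar-sym : ∀ φ x y → polar φ x y ≈ polar φ y x
  polar-sym φ x y = weightedSum-cong φ (λ i → *-comm _ _)

  polar-congˡ : ∀ φ {x x′} z → x ≋ x′ → polar φ x z ≈ polar φ x′ z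
  polar-congˡ φ z x≋x′ = weightedSum-cong φ (λ i → *-congʳ (x≋x′ i))

  polar-congʳ : ∀ φ x {z z′} → z ≋ z′ → polar φ x z ≈ polar φ x z′
  polar-congʳ φ x z≋z′ = weightedSum-cong φ (λ i → *-congˡ (z≋z′ i))

  polar-+ˡ : ∀ φ x y z → polar φ (x +ᵛ y) z ≈ polar φ x z + polar φ y z
  polar-+ˡ φ x y z = trans (weightedSum-cong φ (λ i → distribʳ _ _ _)) (weightedSum-+ φ _ _)

  polar-·ˡ : ∀ φ a x z → polar φ (a ·ᵛ x) z ≈ a * polar φ x z
  polar-·ˡ φ a x z = trans (weightedSum-cong φ (λ i → *-assoc _ _ _)) (weightedSum-* φ a _)

  polar-negʳ : ∀ φ x y → polar φ x (-ᵛ y) ≈ - polar φ x y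
  polar-negʳ φ x y = trans (weightedSum-cong φ (λ i → sym (-‿distribʳ-* (x i) (y i)))) (weightedSum-neg φ _)

  polar-self : ∀ φ x → polar φ x x ≈ value φ x
  polar-self φ x = sym (value≈weightedSum φ x)

  two : K
  two = 1# + 1#

  value-+ : ∀ φ x y → value φ (x +ᵛ y) ≈ value φ x + two * polar φ x y + value φ y
  value-+ φ x y = begin
    value φ (x +ᵛ y)                                          ≈⟨ value≈weightedSum φ _ ⟩
    weightedSum φ (λ i → (x i + y i) * (x i + y i))           ≈⟨ weightedSum-cong φ (λ i → expand (x i) (y i)) ⟩
    weightedSum φ (λ i → (x i * x i + two * (x i * y i)) + y i * y i)
                                                              ≈⟨ weightedSum-+ φ _ _ ⟩
    weightedSum φ (λ i → x i * x i + two * (x i * y i)) + weightedSum φ (λ i → y i * y i)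
                                                              ≈⟨ +-congʳ (weightedSum-+ φ _ _) ⟩
    (weightedSum φ (λ i → x i * x i) + weightedSum φ (λ i → two * (x i * y i))) + weightedSum φ (λ i → y i * y i)
      ≈⟨ +-cong (+-cong (sym (value≈weightedSum φ x)) (weightedSum-* φ two _)) (sym (value≈weightedSum φ y)) ⟩
    value φ x + two * polar φ x y + value φ y                 ∎
    where
    expand : ∀ a b → (a + b) * (a + b) ≈ (a * a + two * (a * b)) + b * b
    expand = solve 2 (λ a b → ((a :+ b) :* (a :+ b)) := ((a :* a :+ con (2 , 0) :* (a :* b)) :+ b :* b)) refl

  value-− : ∀ φ x y → value φ (x +ᵛ -ᵛ y) ≈ value φ x - two * polar φ x y + value φ y
  value-− φ x y = trans (value-+ φ x (-ᵛ y))
    (+-cong (+-congˡ (trans (*-congˡ (polar-negʳ φ x y)) (sym (-‿distribʳ-* two _)))) (value-to (-ᵛ-≅ φ) y))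

  module Reflection (φ : Form) (z : Vector φ) (Qz≉0 : Nonzero (value φ z)) where

    coefficient : Vector φ → K
    coefficient y = two * polar φ y z * value φ z ⁻¹⟨ Qz≉0 ⟩

    reflect : Vector φ → Vector φ
    reflect y = y +ᵛ (- coefficient y) ·ᵛ z

    private
      coefficient-cong : ∀ {y y′} → y ≋ y′ → coefficient y ≈ coefficient y′
      coefficient-cong y≋y′ = *-congʳ (*-congˡ (polar-congˡ φ z y≋y′))

      coefficient-+ : ∀ x y → coefficient (x +ᵛ y) ≈ coefficient x + coefficient y
      coefficient-+ x y = trans (*-congʳ (*-congˡ (polar-+ˡ φ x y z)))
        (solve 4 (λ t a b q → (t :* (a :+ b) :* q) := (t :* a :* q :+ t :* b :* q)) refl two _ _ _)

      coefficient-· : ∀ a x → coefficient (a ·ᵛ x) ≈ a * coefficient x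
      coefficient-· a x = trans (*-congʳ (*-congˡ (polar-·ˡ φ a x z)))
        (solve 4 (λ t a b q → (t :* (a :* b) :* q) := (a :* (t :* b :* q))) refl two a _ _)

      coefficient-value : ∀ y → coefficient y * value φ z ≈ two * polar φ y z
      coefficient-value y = trans (*-assoc _ _ _) (trans (*-congˡ (*-inverseˡ _ Qz≉0)) (*-identityʳ _))

      polar-reflect : ∀ y → polar φ (reflect y) z ≈ - polar φ y z
      polar-reflect y = begin
        polar φ (reflect y) z                                 ≈⟨ polar-+ˡ φ _ _ z ⟩
        polar φ y z + polar φ ((- coefficient y) ·ᵛ z) z      ≈⟨ +-congˡ (polar-·ˡ φ _ z z) ⟩
        polar φ y z + (- coefficient y) * polar φ z z         ≈⟨ +-congˡ (*-congˡ (polar-self φ z)) ⟩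
        polar φ y z + (- coefficient y) * value φ z           ≈⟨ +-congˡ (trans (sym (-‿distribˡ-* _ _)) (-‿cong (coefficient-value y))) ⟩
        polar φ y z + - (two * polar φ y z)                   ≈⟨ solve 1 (λ b → (b :+ :- (con (2 , 0) :* b)) := (:- b)) refl _ ⟩
        - polar φ y z                                         ∎

      reflect-reflect : ∀ y → reflect (reflect y) ≋ y
      reflect-reflect y i = trans (+-congˡ (*-congʳ (-‿cong coefficient-reflect)))
        (solve 3 (λ y l z → ((y :+ (:- l) :* z) :+ (:- (:- l)) :* z) := y) refl (y i) (coefficient y) (z i))
        where
        coefficient-reflect : coefficient (reflect y) ≈ - coefficient y
        coefficient-reflect = trans (*-congʳ (*-congˡ (polar-reflect y)))
          (solve 3 (λ t b q → (t :* (:- b) :* q) := (:- (t :* b :* q))) refl two _ _)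

      value-reflect : ∀ y → value φ (reflect y) ≈ value φ y
      value-reflect y = begin
        value φ (reflect y)
          ≈⟨ value-+ φ y _ ⟩
        value φ y + two * polar φ y ((- l) ·ᵛ z) + value φ ((- l) ·ᵛ z)
          ≈⟨ +-cong (+-congˡ (*-congˡ (trans (polar-sym φ _ _) (trans (polar-·ˡ φ _ z y) (*-congˡ (polar-sym φ z y)))))) (value-· φ _ z) ⟩
        value φ y + two * ((- l) * polar φ y z) + ((- l) * (- l)) * value φ z
          ≈⟨ +-congˡ (trans (solve 2 (λ l q → (((:- l) :* (:- l)) :* q) := (l :* (l :* q))) refl l _) (*-congˡ (coefficient-value y))) ⟩
        value φ y + two * ((- l) * polar φ y z) + l * (two * polar φ y z)
          ≈⟨ solve 4 (λ q t l b → (q :+ t :* ((:- l) :* b) :+ l :* (t :* b)) := q) refl _ two l _ ⟩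
        value φ y ∎
        where l = coefficient y

    reflection-≅ : φ ≅ φ
    reflection-≅ = involution-≅ reflect
      (λ y≋y′ i → +-cong (y≋y′ i) (*-congʳ (-‿cong (coefficient-cong y≋y′))))
      (λ x y i → trans (+-congˡ (*-congʳ (-‿cong (coefficient-+ x y))))
        (solve 5 (λ x y a b z → (x :+ y :+ (:- (a :+ b)) :* z) := ((x :+ (:- a) :* z) :+ (y :+ (:- b) :* z))) refl (x i) (y i) _ _ (z i)))
      (λ a x i → trans (+-congˡ (*-congʳ (-‿cong (coefficient-· a x))))
        (solve 4 (λ a x l z → (a :* x :+ (:- (a :* l)) :* z) := (a :* (x :+ (:- l) :* z))) refl a (x i) _ (z i)))
      reflect-reflect value-reflect

    -- Q(w) = Q(e) makes 2 B(w, w − e) = Q(w − e), i.e. the coefficient of w is 1.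
    reflect-swaps : ∀ w e → value φ w ≈ value φ e → z ≋ w +ᵛ -ᵛ e → reflect w ≋ e
    reflect-swaps w e Qw≈Qe z≋w-e i = begin
      w i + (- coefficient w) * z i    ≈⟨ +-congˡ (*-congʳ (-‿cong coefficient≈1)) ⟩
      w i + (- 1#) * z i               ≈⟨ +-congˡ (trans (-1*x≈-x _) (-‿cong (z≋w-e i))) ⟩
      w i + - (w i + - e i)            ≈⟨ solve 2 (λ w e → (w :+ :- (w :+ :- e)) := e) refl (w i) (e i) ⟩
      e i                              ∎
      where
      B[-e,w]≈-B[w,e] : polar φ (-ᵛ e) w ≈ - polar φ w e
      B[-e,w]≈-B[w,e] = trans (polar-sym φ _ _) (polar-negʳ φ w e)
      2B≈Qz : two * polar φ w z ≈ value φ z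
      2B≈Qz = begin
        two * polar φ w z                             ≈⟨ *-congˡ (trans (polar-sym φ w z) (polar-congˡ φ w z≋w-e)) ⟩
        two * polar φ (w +ᵛ -ᵛ e) w                   ≈⟨ *-congˡ (trans (polar-+ˡ φ _ _ w) (+-cong (polar-self φ w) B[-e,w]≈-B[w,e])) ⟩
        two * (value φ w + - polar φ w e)             ≈⟨ solve 2 (λ q b → (con (2 , 0) :* (q :+ :- b)) := (q :- con (2 , 0) :* b :+ q)) refl _ _ ⟩
        value φ w - two * polar φ w e + value φ w     ≈⟨ +-congˡ Qw≈Qe ⟩
        value φ w - two * polar φ w e + value φ e     ≈⟨ value-− φ w e ⟨
        value φ (w +ᵛ -ᵛ e)                           ≈⟨ value-cong φ z≋w-e ⟨
        value φ z                                     ∎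
      coefficient≈1 : coefficient w ≈ 1#
      coefficient≈1 = trans (*-congʳ 2B≈Qz) (*-inverseʳ _ Qz≉0)

  parallelogram : ∀ φ x y → value φ (x +ᵛ y) + value φ (x +ᵛ -ᵛ y) ≈ two * (value φ x + value φ y)
  parallelogram φ x y = trans (+-cong (value-+ φ x y) (value-− φ x y))
    (solve 3 (λ q b r → ((q :+ con (2 , 0) :* b :+ r) :+ (q :- con (2 , 0) :* b :+ r))
                        := (con (2 , 0) :* (q :+ r))) refl (value φ x) (polar φ x y) (value φ y))

  e₀ : ∀ {n} → Fin (suc n) → K
  e₀ = unit zero

  value-e₀ : ∀ a φ → value (a ∷ φ) e₀ ≈ a
  value-e₀ a φ = trans (+-cong (trans (*-congˡ (*-identityˡ 1#)) (*-identityʳ a)) (value-0 φ)) (+-identityʳ a)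

  polar-e₀ : ∀ a φ y → polar (a ∷ φ) y e₀ ≈ a * y zero
  polar-e₀ a φ y = trans (+-cong (*-congˡ (*-identityʳ _)) (weightedSum-0 φ (λ i → zeroʳ _))) (+-identityʳ _)

  module WittCancellation (2≉0 : Nonzero two) where

    ≅-polar : ∀ {φ ψ} (H : φ ≅ ψ) x y → polar ψ (to H x) (to H y) ≈ polar φ x y
    ≅-polar {φ} {ψ} H x y = *-cancelˡ 2≉0 (+-cancelˡ (value φ x) _ _ (+-cancelʳ (value φ y) _ _ (begin
      value φ x + two * polar ψ (to H x) (to H y) + value φ y                ≈⟨ +-cong (+-congʳ (sym (value-to H x))) (sym (value-to H y)) ⟩
      value ψ (to H x) + two * polar ψ (to H x) (to H y) + value ψ (to H y)  ≈⟨ value-+ ψ _ _ ⟨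
      value ψ (to H x +ᵛ to H y)                                             ≈⟨ value-cong ψ (≋-sym (to-+ H x y)) ⟩
      value ψ (to H (x +ᵛ y))                                                ≈⟨ value-to H _ ⟩
      value φ (x +ᵛ y)                                                       ≈⟨ value-+ φ x y ⟩
      value φ x + two * polar φ x y + value φ y                              ∎)))

    private
      ∷ᵛ-cong : ∀ {n} {x y : Fin n → K} → x ≋ y → 0# ∷ᵛ x ≋ 0# ∷ᵛ y
      ∷ᵛ-cong x≋y zero    = refl
      ∷ᵛ-cong x≋y (suc i) = x≋y i

      ∷ᵛ-+ : ∀ {n} (x y : Fin n → K) → 0# ∷ᵛ (x +ᵛ y) ≋ (0# ∷ᵛ x) +ᵛ (0# ∷ᵛ y)
      ∷ᵛ-+ x y zero    = sym (+-identityˡ 0#)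
      ∷ᵛ-+ x y (suc i) = refl

      ∷ᵛ-· : ∀ {n} a (x : Fin n → K) → 0# ∷ᵛ (a ·ᵛ x) ≋ a ·ᵛ (0# ∷ᵛ x)
      ∷ᵛ-· a x zero    = sym (zeroʳ a)
      ∷ᵛ-· a x (suc i) = refl

      ∷ᵛ-tail : ∀ {n} (y : Fin (suc n) → K) → y zero ≈ 0# → 0# ∷ᵛ tail y ≋ y
      ∷ᵛ-tail y y₀≈0 zero    = sym y₀≈0
      ∷ᵛ-tail y y₀≈0 (suc i) = refl

    -- H preserves the polar form and fixes e₀, so it maps e₀⊥ = {0 ∷ᵛ x} into itself.
    fixes-e₀⇒head-0 : ∀ {a φ ψ} → Nonzero a → (H : (a ∷ φ) ≅ (a ∷ ψ)) → to H e₀ ≋ e₀ →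
      ∀ x → to H (0# ∷ᵛ x) zero ≈ 0#
    fixes-e₀⇒head-0 {a} {φ} {ψ} a≉0 H He₀≋e₀ x = *-cancelˡ a≉0 (begin
      a * y zero                     ≈⟨ polar-e₀ a ψ y ⟨
      polar (a ∷ ψ) y e₀             ≈⟨ polar-congʳ (a ∷ ψ) y (≋-sym He₀≋e₀) ⟩
      polar (a ∷ ψ) y (to H e₀)      ≈⟨ ≅-polar H (0# ∷ᵛ x) e₀ ⟩
      polar (a ∷ φ) (0# ∷ᵛ x) e₀     ≈⟨ polar-e₀ a φ (0# ∷ᵛ x) ⟩
      a * 0#                         ∎)
      where y = to H (0# ∷ᵛ x)

    fixes-e₀⇒≅ : ∀ {a φ ψ} → Nonzero a → (H : (a ∷ φ) ≅ (a ∷ ψ)) → to H e₀ ≋ e₀ → φ ≅ ψ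
    fixes-e₀⇒≅ {a} {φ} {ψ} a≉0 H He₀≋e₀ = record
      { to = λ x → tail (to H (0# ∷ᵛ x))
      ; from = λ y → tail (from H (0# ∷ᵛ y))
      ; to-cong = λ p i → to-cong H (∷ᵛ-cong p) (suc i)
      ; from-cong = λ p i → from-cong H (∷ᵛ-cong p) (suc i)
      ; to-+ = λ x y i → trans (to-cong H (∷ᵛ-+ x y) (suc i)) (to-+ H _ _ (suc i))
      ; to-· = λ a x i → trans (to-cong H (∷ᵛ-· a x) (suc i)) (to-· H _ _ (suc i))
      ; from-to = λ x i → trans (from-cong H (∷ᵛ-tail _ (head-0 x)) (suc i)) (from-to H _ (suc i))
      ; to-from = λ y i → trans (to-cong H (∷ᵛ-tail _ (fixes-e₀⇒head-0 a≉0 (≅-sym H) He₀≋e₀′ y)) (suc i)) (to-from H _ (suc i))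
      ; value-to = λ x → let y = to H (0# ∷ᵛ x) in begin
          value ψ (tail y)                    ≈⟨ +-identityˡ _ ⟨
          0# + value ψ (tail y)               ≈⟨ +-congʳ (sym (trans (*-congˡ (trans (*-congʳ (head-0 x)) (zeroˡ _))) (zeroʳ a))) ⟩
          value (a ∷ ψ) y                     ≈⟨ value-to H _ ⟩
          a * (0# * 0#) + value φ x           ≈⟨ trans (+-congʳ (trans (*-congˡ (zeroˡ 0#)) (zeroʳ a))) (+-identityˡ _) ⟩
          value φ x                           ∎ }
      where
      head-0 = fixes-e₀⇒head-0 a≉0 H He₀≋e₀
      He₀≋e₀′ : from H e₀ ≋ e₀
      He₀≋e₀′ = ≋-trans (from-cong H (≋-sym He₀≋e₀)) (from-to H e₀)

    -- Either Q(w − e₀) ≉ 0 or Q(w + e₀) ≉ 0, since their sum is 4a; the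
    -- reflection in that vector, followed by −1 in the second case, carries
    -- w = H e₀ back to e₀.
    ⟨a⟩⊥-cancel : ∀ {a φ ψ} → Nonzero a → (a ∷ φ) ≅ (a ∷ ψ) → φ ≅ ψ
    ⟨a⟩⊥-cancel {a} {φ} {ψ} a≉0 H = by-cases (≈0? (value (a ∷ ψ) (w +ᵛ -ᵛ e₀)))
      where
      w = to H e₀
      Qw≈Qe₀ : value (a ∷ ψ) w ≈ value (a ∷ ψ) e₀
      Qw≈Qe₀ = trans (value-to H e₀) (trans (value-e₀ a φ) (sym (value-e₀ a ψ)))
      by-cases : Dec (value (a ∷ ψ) (w +ᵛ -ᵛ e₀) ≈ 0#) → φ ≅ ψ
      by-cases (no Q≉0) = fixes-e₀⇒≅ a≉0 (≅-trans H R.reflection-≅) (R.reflect-swaps w e₀ Qw≈Qe₀ ≋-refl)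
        where module R = Reflection (a ∷ ψ) (w +ᵛ -ᵛ e₀) Q≉0
      by-cases (yes Q≈0) = fixes-e₀⇒≅ a≉0 (≅-trans H (≅-trans R.reflection-≅ (-ᵛ-≅ (a ∷ ψ)))) fixed
        where
        Q[w+e₀]≈4a : value (a ∷ ψ) (w +ᵛ e₀) ≈ (two * two) * a
        Q[w+e₀]≈4a = begin
          value (a ∷ ψ) (w +ᵛ e₀)                                      ≈⟨ +-identityʳ _ ⟨
          value (a ∷ ψ) (w +ᵛ e₀) + 0#                                 ≈⟨ +-congˡ Q≈0 ⟨
          value (a ∷ ψ) (w +ᵛ e₀) + value (a ∷ ψ) (w +ᵛ -ᵛ e₀)         ≈⟨ parallelogram (a ∷ ψ) w e₀ ⟩
          two * (value (a ∷ ψ) w + value (a ∷ ψ) e₀)                   ≈⟨ *-congˡ (+-cong (trans Qw≈Qe₀ (value-e₀ a ψ)) (value-e₀ a ψ)) ⟩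
          two * (a + a)                                                ≈⟨ solve 1 (λ a → (con (2 , 0) :* (a :+ a)) := ((con (2 , 0) :* con (2 , 0)) :* a)) refl a ⟩
          (two * two) * a                                              ∎
        module R = Reflection (a ∷ ψ) (w +ᵛ e₀) (nonzero-cong (sym Q[w+e₀]≈4a) (*-nonzero (*-nonzero 2≉0 2≉0) a≉0))
        Rw≋-e₀ : R.reflect w ≋ -ᵛ e₀
        Rw≋-e₀ = R.reflect-swaps w (-ᵛ e₀) (trans Qw≈Qe₀ (sym (value-to (-ᵛ-≅ (a ∷ ψ)) e₀))) (λ i → +-congˡ (sym (-‿involutive _)))
        fixed : -ᵛ R.reflect w ≋ e₀
        fixed i = trans (-‿cong (Rw≋-e₀ i)) (-‿involutive _)

    witt-cancel : ∀ {χ φ ψ} → Nondegenerate χ → χ ⊥ φ ≅ χ ⊥ ψ → φ ≅ ψ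
    witt-cancel []            H = H
    witt-cancel (a≉0 ∷ χ≉0)   H = witt-cancel χ≉0 (⟨a⟩⊥-cancel a≉0 H)

  D∞⇒nonzero : ∀ {t} → D∞ t → Nonzero t
  D∞⇒nonzero (_ , t≉0 , _) = t≉0

  D-≤′ : ∀ {j N x} → j ≤′ N → D j x → D N x
  D-≤′ (ℕ.≤′-reflexive ≡.refl) Dx = Dx
  D-≤′ (ℕ.≤′-step j≤′N)        Dx with D-≤′ j≤′N Dx
  ... | x≉0 , y , x≈Σy² = x≉0 , 0# ∷ᵛ y , trans x≈Σy² (sym (trans (+-congʳ (zeroˡ 0#)) (+-identityˡ _)))

  AllOnes : Form → Set (c ⊔ ℓ)
  AllOnes = All (_≈ 1#)

  value-ones : ∀ {α} → AllOnes α → ∀ x → value α x ≈ sumFin (dim α) (λ i → x i * x i)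
  value-ones []           x = refl
  value-ones (a≈1 ∷ α≈1) x = +-cong (trans (*-congʳ a≈1) (*-identityˡ _)) (value-ones α≈1 (λ i → x (suc i)))

  ones-represents⇒D : ∀ {α x} → AllOnes α → Nonzero x → Represents α x → D (dim α) x
  ones-represents⇒D α≈1 x≉0 (u , αu≈x) = x≉0 , u , trans (sym αu≈x) (value-ones α≈1 u)

  D⇒ones-represents : ∀ {α x} → AllOnes α → D (dim α) x → Represents α x
  D⇒ones-represents α≈1 (_ , y , x≈Σy²) = y , trans (value-ones α≈1 y) (sym x≈Σy²)

  -- σ r = ⟨⟨−1, …, −1⟩⟩ = 2ʳ × ⟨1⟩, so σ r represents exactly D_F(2ʳ) ∪ {0}.
  σ : ℕ → Form
  σ r = pfister r (λ _ → - 1#)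

  σ-ones : ∀ r → AllOnes (σ r)
  σ-ones zero    = refl ∷ []
  σ-ones (suc r) = All.++⁺ (σ-ones r) (All.map⁺ (All.map (λ a≈1 → trans (*-cong (-‿involutive 1#) a≈1) (*-identityˡ 1#)) (σ-ones r)))

  σ-represents⇒D : ∀ r {x} → Nonzero x → Represents (σ r) x → D (2 ^ r) x
  σ-represents⇒D r x≉0 σx = ≡.subst (λ d → D d _) (dim-pfister r _) (ones-represents⇒D (σ-ones r) x≉0 σx)

  D⇒σ-represents : ∀ r {j x} → j ℕ.≤ 2 ^ r → D j x → Represents (σ r) x
  D⇒σ-represents r j≤2ʳ Dx =
    D⇒ones-represents (σ-ones r) (D-≤′ (ℕ.≤⇒≤′ (ℕ.≤-trans j≤2ʳ (ℕ.≤-reflexive (≡.sym (dim-pfister r _))))) Dx)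

  -1≉0 : Nonzero (- 1#)
  -1≉0 = -‿nonzero 1≉0

  σ-round : ∀ r → Round (σ r)
  σ-round r = pfister-round r _ (λ _ → -1≉0)

  π-entries : ∀ r → K → Fin (suc r) → K
  π-entries r t = t ∷ᵛ λ _ → - 1#

  π : ℕ → K → Form
  π r t = pfister (suc r) (π-entries r t)

  π-entries≉0 : ∀ r t → Nonzero t → ∀ i → Nonzero (π-entries r t i)
  π-entries≉0 r t t≉0 zero    = t≉0
  π-entries≉0 r t t≉0 (suc i) = -1≉0

  π-round : ∀ r t → Nonzero t → Round (π r t)
  π-round r t t≉0 = pfister-round (suc r) (π-entries r t) (π-entries≉0 r t t≉0)

  n≤2^n : ∀ n → n ℕ.≤ 2 ^ n
  n≤2^n zero    = z≤n
  n≤2^n (suc n) = ℕ.+-mono-≤ (ℕ.m^n>0 2 n) (ℕ.≤-trans (n≤2^n n) (ℕ.m≤m+n _ 0))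

  dim-multiple : ∀ M α → dim (multiple M α) ≡ M ℕ.* dim α
  dim-multiple zero    α = ≡.refl
  dim-multiple (suc M) α = ≡.trans (List.length-++ α) (≡.cong (dim α ℕ.+_) (dim-multiple M α))

  all-multiple : ∀ {P : K → Set ℓ} M {α} → All P α → All P (multiple M α)
  all-multiple M Pα = All.concat⁺ (All.replicate⁺ M Pα)

  all≈-pointwise : ∀ {k α β} → All (_≈ k) α → All (_≈ k) β → dim α ≡ dim β → Pointwise _≈_ α β
  all≈-pointwise []           []           _  = []
  all≈-pointwise (a≈k ∷ α≈k) (b≈k ∷ β≈k) eq = trans a≈k (sym b≈k) ∷ all≈-pointwise α≈k β≈k (ℕ.suc-injective eq)

  multiple-⊥ : ∀ M α β → multiple M (α ⊥ β) ↭.↭ multiple M α ⊥ multiple M β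
  multiple-⊥ zero    α β = ↭.↭-refl
  multiple-⊥ (suc M) α β = ↭.↭-trans (↭-Properties.++⁺ˡ (α ⊥ β) (multiple-⊥ M α β)) (interchange α β _ _)
    where
    interchange : ∀ α β γ δ → (α ⊥ β) ⊥ (γ ⊥ δ) ↭.↭ (α ⊥ γ) ⊥ (β ⊥ δ)
    interchange α β γ δ = ↭.↭-trans (↭.↭-reflexive (List.++-assoc α β _))
      (↭.↭-trans (↭-Properties.++⁺ˡ α (↭-Properties.shifts β γ))
                 (↭.↭-reflexive (≡.sym (List.++-assoc α γ _))))

  multiple-scale : ∀ M b α → multiple M (scale b α) ≡ scale b (multiple M α)
  multiple-scale zero    b α = ≡.refl
  multiple-scale (suc M) b α = ≡.trans (≡.cong (scale b α ⊥_) (multiple-scale M b α)) (≡.sym (List.map-++ (b *_) α _))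

  multiple-σ : ∀ j r → multiple (2 ^ j) (σ r) ≅ σ (j ℕ.+ r)
  multiple-σ j r = pointwise-≅ (all≈-pointwise (all-multiple (2 ^ j) (σ-ones r)) (σ-ones (j ℕ.+ r)) dims)
    where
    dims : dim (multiple (2 ^ j) (σ r)) ≡ dim (σ (j ℕ.+ r))
    dims = ≡.trans (dim-multiple (2 ^ j) (σ r)) (≡.trans (≡.cong (2 ^ j ℕ.*_) (dim-pfister r _))
             (≡.trans (≡.sym (ℕ.^-distribˡ-+-* 2 j r)) (≡.sym (dim-pfister (j ℕ.+ r) _))))

  multiple-π : ∀ j r t → multiple (2 ^ j) (π r t) ≅ π (j ℕ.+ r) t
  multiple-π j r t =
    multiple M (σ r ⊥ scale (- t) (σ r))                ≅⟨ ↭⇒≅ (multiple-⊥ M (σ r) (scale (- t) (σ r))) ⟩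
    multiple M (σ r) ⊥ multiple M (scale (- t) (σ r))   ≅⟨ ≅-reflexive (≡.cong (multiple M (σ r) ⊥_) (multiple-scale M (- t) (σ r))) ⟩
    multiple M (σ r) ⊥ scale (- t) (multiple M (σ r))   ≅⟨ ⊥-cong (multiple-σ j r) (scale-cong (- t) (multiple-σ j r)) ⟩
    σ (j ℕ.+ r) ⊥ scale (- t) (σ (j ℕ.+ r))             ≅∎
    where M = 2 ^ j

  hyperbolic-↭ : ∀ N → hyperbolic N ↭.↭ replicate N 1# ⊥ replicate N (- 1#)
  hyperbolic-↭ zero    = ↭.↭-refl
  hyperbolic-↭ (suc N) = ↭.prep refl (↭.↭-trans (↭.prep refl (hyperbolic-↭ N)) (↭.↭-sym (↭-Properties.↭-shift (replicate N 1#) _)))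

  -- t ρ ≅ ρ by roundness, so this is ρ ⊥ −ρ.
  round-⊥-scale-hyperbolic : ∀ {ρ t} → Round ρ → AllOnes ρ → Nonzero t → Represents ρ t →
    ρ ⊥ scale (- t) ρ ≅ hyperbolic (dim ρ)
  round-⊥-scale-hyperbolic {ρ} {t} ρ-round ρ≈1 t≉0 ρt =
    ρ ⊥ scale (- t) ρ                                   ≅⟨ ⊥-cong ≅-refl (scale-similar ρ (sym (-1*x≈-x t)) (ρ-round t≉0 ρt)) ⟩
    ρ ⊥ scale (- 1#) ρ                                  ≅⟨ ⊥-cong (pointwise-≅ ones) (pointwise-≅ minus-ones) ⟩
    replicate N 1# ⊥ replicate N (- 1#)                 ≅⟨ ≅-sym (↭⇒≅ (hyperbolic-↭ N)) ⟩
    hyperbolic N                                        ≅∎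
    where
    N = dim ρ
    ones : Pointwise _≈_ ρ (replicate N 1#)
    ones = all≈-pointwise ρ≈1 (All.replicate⁺ N refl) (≡.sym (List.length-replicate N))
    minus-ones : Pointwise _≈_ (scale (- 1#) ρ) (replicate N (- 1#))
    minus-ones = all≈-pointwise (All.map⁺ (All.map (λ a≈1 → trans (*-congˡ a≈1) (*-identityʳ _)) ρ≈1)) (All.replicate⁺ N refl)
      (≡.trans (List.length-map _ ρ) (≡.sym (List.length-replicate N)))

  π-torsion : ∀ r {t} → Nonzero t → D∞ t → Torsion (π r t)
  π-torsion r {t} t≉0 (j , Dt) = 2 ^ j , ℕ.m^n>0 2 j , dim (σ (j ℕ.+ r)) , ≅⇒isometric
    (≅-trans (multiple-π j r t) (round-⊥-scale-hyperbolic (σ-round (j ℕ.+ r)) (σ-ones (j ℕ.+ r)) t≉0 σt))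
    where
    j≤2^[j+r] : j ℕ.≤ 2 ^ (j ℕ.+ r)
    j≤2^[j+r] = ℕ.≤-trans (n≤2^n j) (ℕ.^-monoʳ-≤ 2 (ℕ.m≤m+n j r))
    σt = D⇒σ-represents (j ℕ.+ r) j≤2^[j+r] Dt

  dim≡0⇒[] : ∀ (χ : Form) → dim χ ≡ 0 → χ ≡ []
  dim≡0⇒[] [] _ = ≡.refl

  -- Maximality of φ and dim φ ≤ dim ψ leave no room for a complement.
  supreme-torsion-similar : ∀ {φ ψ} → SupremeTorsion φ → Nondegenerate ψ → Anisotropic ψ → Torsion ψ →
    dim φ ℕ.≤ dim ψ → Σ K λ a → Nonzero a × φ ≅ scale a ψ
  supreme-torsion-similar {φ} {ψ} (_ , _ , _ , maximal) ψ≉0 ψ-anisotropic ψ-torsion dimφ≤dimψ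
    with maximal ψ ψ≉0 ψ-anisotropic ψ-torsion
  ... | a , a≉0 , χ , _ , φ≅aψ⊥χ = a , a≉0 , ≅-trans I (≅-reflexive (≡.trans (≡.cong (scale a ψ ⊥_) χ≡[]) (List.++-identityʳ _)))
    where
    I = isometric⇒≅ φ≅aψ⊥χ
    dimψ+dimχ≤dimψ+0 : dim ψ ℕ.+ dim χ ℕ.≤ dim ψ ℕ.+ 0
    dimψ+dimχ≤dimψ+0 = ℕ.≤-trans
      (ℕ.≤-reflexive (≡.sym (≡.trans (≅-dim I) (≡.trans (List.length-++ (scale a ψ)) (≡.cong (ℕ._+ dim χ) (List.length-map _ ψ))))))
      (ℕ.≤-trans dimφ≤dimψ (ℕ.≤-reflexive (≡.sym (ℕ.+-identityʳ _))))
    χ≡[] : χ ≡ []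
    χ≡[] = dim≡0⇒[] χ (ℕ.n≤0⇒n≡0 (ℕ.+-cancelˡ-≤ (dim ψ) _ _ dimψ+dimχ≤dimψ+0))

  module FormallyRealField (formallyReal : FormallyReal) where

    -- y₀ ≉ 0 would give −1 = Σ (yᵢ / y₀)².
    sumOfSquares≈0 : ∀ n (y : Fin n → K) → sumFin n (λ i → y i * y i) ≈ 0# → y ≋ 0ᵛ
    sumOfSquares≈0 (suc n) y Σy²≈0 = λ { zero → y₀≈0 ; (suc i) → sumOfSquares≈0 n (tail y) S≈0 i }
      where
      S = sumFin n (λ i → y (suc i) * y (suc i))
      S≈-y₀² : S ≈ - (y zero * y zero)
      S≈-y₀² = +-inverseʳ-unique _ _ Σy²≈0
      y₀≈0 : y zero ≈ 0#
      y₀≈0 with ≈0? (y zero)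
      ... | yes y₀≈0 = y₀≈0
      ... | no  y₀≉0 = ⊥-elim (formallyReal (n , -1≉0 , (λ i → y (suc i) * z) , sym Σ≈-1))
        where
        z = y zero ⁻¹⟨ y₀≉0 ⟩
        Σ≈-1 : sumFin n (λ i → (y (suc i) * z) * (y (suc i) * z)) ≈ - 1#
        Σ≈-1 = begin
          sumFin n (λ i → (y (suc i) * z) * (y (suc i) * z))   ≈⟨ sumFin-cong n (λ i → trans (*-interchange _ z _ z) (*-comm _ _)) ⟩
          sumFin n ((z * z) ·ᵛ (λ i → y (suc i) * y (suc i)))  ≈⟨ sumFin-* n (z * z) _ ⟩
          (z * z) * S                                          ≈⟨ *-congˡ S≈-y₀² ⟩
          (z * z) * - (y zero * y zero)                        ≈⟨ solve 2 (λ z a → ((z :* z) :* (:- (a :* a))) := (:- ((z :* a) :* (z :* a)))) refl z (y zero) ⟩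
          - ((z * y zero) * (z * y zero))                      ≈⟨ -‿cong (*-cong (*-inverseˡ _ y₀≉0) (*-inverseˡ _ y₀≉0)) ⟩
          - (1# * 1#)                                          ≈⟨ -‿cong (*-identityˡ 1#) ⟩
          - 1#                                                 ∎
      S≈0 : S ≈ 0#
      S≈0 = trans S≈-y₀² (trans (-‿cong (trans (*-congʳ y₀≈0) (zeroˡ _))) -0#≈0#)

    two≉0 : Nonzero two
    two≉0 1+1≈0 = formallyReal (1 , -1≉0 , (λ _ → 1#) , -1≈1²)
      where
      -1≈1² : - 1# ≈ 1# * 1# + 0#
      -1≈1² = trans (sym (+-inverseʳ-unique _ _ 1+1≈0)) (sym (trans (+-identityʳ _) (*-identityˡ 1#)))

    ones-anisotropic : ∀ {α} → AllOnes α → Anisotropic α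
    ones-anisotropic α≈1 x αx≈0 = sumOfSquares≈0 _ x (trans (sym (value-ones α≈1 x)) αx≈0)

    π-anisotropic : ∀ r {t} → Nonzero t → ¬ D (2 ^ r) t → Anisotropic (π r t)
    π-anisotropic r {t} t≉0 ¬Dt v πv≈0 =
      ≋-trans (≋-sym (join-proj ρ ρ′ v)) (≋-trans (join-cong ρ ρ′ v₁≋0 projʳv≋0) (join-0ᵛ ρ ρ′))
      where
      ρ = σ r
      ρ′ = scale (- t) ρ
      v₁ = projˡ ρ ρ′ v
      v₂ = unscale (- t) ρ (projʳ ρ ρ′ v)
      A = value ρ v₁
      C = value ρ v₂
      A≈tC : A ≈ t * C
      A≈tC = trans (+-inverseˡ-unique _ _ (trans (sym (trans (value-⊥ ρ ρ′ v) (+-congˡ (value-scale (- t) ρ _)))) πv≈0))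
                   (trans (-‿cong (sym (-‿distribˡ-* t C))) (-‿involutive _))
      C≈0 : C ≈ 0#
      C≈0 with ≈0? C
      ... | yes C≈0 = C≈0
      ... | no  C≉0 = ⊥-elim (¬Dt (σ-represents⇒D r t≉0 (round-represents-/ (σ-round r) C≉0 (v₁ , refl) (v₂ , refl) A≈tC)))
      v₁≋0 : v₁ ≋ 0ᵛ
      v₁≋0 = ones-anisotropic (σ-ones r) v₁ (trans A≈tC (trans (*-congˡ C≈0) (zeroʳ t)))
      projʳv≋0 : projʳ ρ ρ′ v ≋ 0ᵛ
      projʳv≋0 j = trans (sym (rescale-unscale (- t) ρ (projʳ ρ ρ′ v) j)) (ones-anisotropic (σ-ones r) v₂ C≈0 _)

  module SupremePfister (formallyReal : FormallyReal) {n φ} (φ-pfister : IsPfister n φ) (φ-supreme : SupremeTorsion φ) where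
    open FormallyRealField formallyReal
    open WittCancellation two≉0

    r : ℕ
    r = n ℕ.∸ 1

    -- dim φ = 2ⁿ ≤ 2 ^ (1 + (n ∸ 1)); the inequality is strict only for n = 0.
    dimφ≤dimπ : ∀ t → dim φ ℕ.≤ dim (π r t)
    dimφ≤dimπ t = ℕ.≤-trans (ℕ.≤-reflexive dimφ≡2ⁿ)
      (ℕ.≤-trans (ℕ.^-monoʳ-≤ 2 (ℕ.m≤n+m∸n n 1)) (ℕ.≤-reflexive (≡.sym (dim-pfister (suc r) (π-entries r t)))))
      where
      dimφ≡2ⁿ : dim φ ≡ 2 ^ n
      dimφ≡2ⁿ = ≡.trans (≅-dim (isometric⇒≅ {φ} {pfister n (proj₁ φ-pfister)} (proj₂ (proj₂ φ-pfister))))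
                        (dim-pfister n (proj₁ φ-pfister))

    φ-similar-π : ∀ {t} → D∞ t → ¬ D (2 ^ r) t → Σ K λ a → Nonzero a × φ ≅ scale a (π r t)
    φ-similar-π {t} D∞t ¬Dt = supreme-torsion-similar φ-supreme
      (pfister-nondegenerate (suc r) (π-entries r t) (π-entries≉0 r t t≉0))
      (π-anisotropic r t≉0 ¬Dt) (π-torsion r t≉0 D∞t) (dimφ≤dimπ t)
      where
      t≉0 : Nonzero t
      t≉0 = D∞⇒nonzero D∞t

    π-≅ : ∀ {x t} → D∞ x → ¬ D (2 ^ r) x → D∞ t → ¬ D (2 ^ r) t → π r x ≅ π r t
    π-≅ {x} {t} D∞x ¬Dx D∞t ¬Dt =
      π r x              ≅⟨ πx≅eπt ⟩
      scale e (π r t)    ≅⟨ scale-represents-1⇒≅ (π-round r t t≉0) (represents-≅ πx≅eπt (pfister-represents-1 (suc r) (π-entries r x))) ⟩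
      π r t              ≅∎
      where
      t≉0 : Nonzero t
      t≉0 = D∞⇒nonzero D∞t
      similarˣ = φ-similar-π D∞x ¬Dx
      similarᵗ = φ-similar-π D∞t ¬Dt
      a≉0 = proj₁ (proj₂ similarˣ)
      e = proj₁ similarˣ ⁻¹⟨ a≉0 ⟩ * proj₁ similarᵗ
      πx≅eπt : π r x ≅ scale e (π r t)
      πx≅eπt = scale-≅-cancelˡ a≉0 (≅-trans (≅-sym (proj₂ (proj₂ similarˣ))) (proj₂ (proj₂ similarᵗ)))

    -- Cancelling σ r from σ r ⊥ −x σ r ≅ σ r ⊥ −t σ r leaves −x σ r ≅ −t σ r.
    quotient-in-D : ∀ {x t} → D∞ x → ¬ D (2 ^ r) x → D∞ t → ¬ D (2 ^ r) t → Σ K λ y → D (2 ^ r) y × x ≈ t * y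
    quotient-in-D {x} {t} D∞x ¬Dx D∞t ¬Dt = y , σ-represents⇒D r y≉0 σy , x≈ty
      where
      -xσ≅-tσ : scale (- x) (σ r) ≅ scale (- t) (σ r)
      -xσ≅-tσ = witt-cancel (pfister-nondegenerate r _ (λ _ → -1≉0)) (π-≅ D∞x ¬Dx D∞t ¬Dt)
      quotient = scale-≅⇒quotient -xσ≅-tσ (pfister-represents-1 r _)
      y = proj₁ quotient
      σy = proj₁ (proj₂ quotient)
      x≈ty : x ≈ t * y
      x≈ty = -‿injective (trans (proj₂ (proj₂ quotient)) (sym (-‿distribˡ-* t y)))
      y≉0 : Nonzero y
      y≉0 y≈0 = D∞⇒nonzero {x} D∞x (trans x≈ty (trans (*-congˡ y≈0) (zeroʳ t)))

proposition5p1 : ∀ {c ℓ : Level} →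
    -- classical metatheory (the paper's setting): excluded middle
    (∀ (P : Set (c ⊔ ℓ)) → Dec P) →
    (F : Field c ℓ) → let open QuadraticForms F in
    FormallyReal → ¬ Pythagorean →
    (n : ℕ) (φ : Form) → IsPfister n φ → SupremeTorsion φ →
    ¬ PythagorasAtMost (2 ^ (n ∸ 1)) →
    IndexTwo (2 ^ (n ∸ 1))
proposition5p1 {c} em F formallyReal _ n φ φ-pfister φ-supreme p>2ⁿ⁻¹ = by-cases (em (∃ λ t → D∞ t × ¬ D m t))
  where
  open Field F using (Carrier; _≈_; _*_; 0#)
  open QuadraticForms F
  open FormTheory F (λ x → map′ lower lift (em (Lift c (x ≈ 0#))))
  open SupremePfister formallyReal φ-pfister φ-supreme using (quotient-in-D)
  m = 2 ^ (n ∸ 1)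
  by-cases : Dec (∃ λ t → D∞ t × ¬ D m t) → IndexTwo m
  by-cases (yes (t , D∞t , ¬Dt)) = t , D∞t , ¬Dt , λ x D∞x → coset x D∞x (em (D m x))
    where
    coset : ∀ x → D∞ x → Dec (D m x) → D m x ⊎ Σ Carrier λ y → D m y × x ≈ t * y
    coset x D∞x (yes Dx)  = inj₁ Dx
    coset x D∞x (no  ¬Dx) = inj₂ (quotient-in-D D∞x ¬Dx D∞t ¬Dt)
  by-cases (no ∄t) = ⊥-elim (p>2ⁿ⁻¹ λ x D∞x → decidable-stable (em (D m x)) (λ ¬Dx → ∄t (x , D∞x , ¬Dx)))
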